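{- Let $x$ be an involution in $S_n$. Then $|\mathcal{A}(x)|=1$ if and only if $x$ is 321-avoiding.
   Context: $S_n$ has simple generators $s_i=(i,i+1)$ and length $\ell$. The Demazure product $\circ$ is the unique associative operation on $S_n$ with $s\circ w = sw$ if $\ell(sw)>\ell(w)$ and $s\circ w=w$ otherwise, and $w\circ s=ws$ if $\ell(ws)>\ell(w)$ and $w\circ s = w$ otherwise. $\mathcal{A}(x)$ is the set of minimal-length $w\in S_n$ with $w^{ -1}\circ w=x$. A permutation $w$ is 321-avoiding if there are no $i<j<k$ with $w(i)>w(j)>w(k)$. -}

module Defs where

open import Data.Nat using (ℕ; zero; suc; _+_; _<_; _≤_)
open import Data.Fin using (Fin; toℕ; fromℕ<; inject₁)
import Data.Fin as F
open import Data.Fin.Permutation using (Permutation′; _⟨$⟩ʳ_; _∘ₚ_; flip; transpose; id; _≈_)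
open import Data.List using (List; []; _∷_; length; filter; allFin; concatMap; map)
open import Data.Product using (Σ; _×_; _,_; ∃; proj₁)
open import Relation.Nullary using (¬_)
open import Relation.Unary using (Pred)
open import Relation.Binary.PropositionalEquality using (_≡_)
open import Data.Fin.Properties using (_<?_)
open import Level using (0ℓ)

S : ℕ → Set
S n = Permutation′ n

-- Group product with the usual convention (u · v)(i) = u (v i).
infixl 7 _·_
_·_ : ∀ {n} → S n → S n → S n
u · v = v ∘ₚ u

_⁻¹ : ∀ {n} → S n → S n
u ⁻¹ = flip u

-- Simple generators s_i = (i, i+1), indexed (0-based) by i with i + 1 < n.
Gen : ℕ → Set
Gen n = Σ (Fin n) λ i → suc (toℕ i) < n

s : ∀ {n} → Gen n → S n
s (i , p) = transpose i (fromℕ< p)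

inversions : ∀ {n} → S n → List (Fin n × Fin n)
inversions {n} w =
  filter (λ { (i , j) → w ⟨$⟩ʳ j <? w ⟨$⟩ʳ i })
    (filter (λ { (i , j) → i <? j })
      (concatMap (λ i → map (λ j → (i , j)) (allFin n)) (allFin n)))

-- Length ℓ(w) = number of inversions (= Coxeter length w.r.t. the s_i).
ℓ : ∀ {n} → S n → ℕ
ℓ w = length (inversions w)

prod : ∀ {n} → List (Gen n) → S n
prod []      = id
prod (a ∷ as) = s a · prod as

IsReducedWord : ∀ {n} → List (Gen n) → S n → Set
IsReducedWord as u = (prod as ≈ u) × (length as ≡ ℓ u)

-- Left Demazure action of a generator: s ∘ w = s w if ℓ(s w) > ℓ(w), else w.
-- Stated relationally: DemGen a w z  means  s_a ∘ w = z.
-- (results are taken up to pointwise equality _≈_ of permutations)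
data DemGen {n} (a : Gen n) (w : S n) (z : S n) : Set where
  up   : ℓ w < ℓ (s a · w) → s a · w ≈ z → DemGen a w z
  down : ¬ (ℓ w < ℓ (s a · w)) → w ≈ z → DemGen a w z

data DemWord {n} : List (Gen n) → S n → S n → Set where
  nil  : ∀ {w z} → w ≈ z → DemWord [] w z
  cons : ∀ {a as w y z} → DemWord as w y → DemGen a y z → DemWord (a ∷ as) w z

-- Since ∘ is associative and s ∘ v is given
-- by the rule above, for any reduced word a₁⋯a_k of u we have
-- u = s_{a₁} ∘ ⋯ ∘ s_{a_k}, hence u ∘ w = s_{a₁} ∘ ( ⋯ (s_{a_k} ∘ w)).
Demazure : ∀ {n} → S n → S n → S n → Set
Demazure u w z = ∃ λ as → IsReducedWord as u × DemWord as w z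

𝒜 : ∀ {n} → S n → Pred (S n) 0ℓ
𝒜 x w = Demazure (w ⁻¹) w x × (∀ v → Demazure (v ⁻¹) v x → ℓ w ≤ ℓ v)

HasExactlyOne : ∀ {n} → Pred (S n) 0ℓ → Set
HasExactlyOne P = ∃ λ w → P w × (∀ v → P v → v ≈ w)

IsInvolution : ∀ {n} → S n → Set
IsInvolution x = ∀ i → x ⟨$⟩ʳ (x ⟨$⟩ʳ i) ≡ i

Avoids321 : ∀ {n} → S n → Set
Avoids321 {n} w = ¬ (Σ (Fin n) λ i → Σ (Fin n) λ j → Σ (Fin n) λ k →
  (i F.< j) × (j F.< k) × (w ⟨$⟩ʳ j F.< w ⟨$⟩ʳ i) × (w ⟨$⟩ʳ k F.< w ⟨$⟩ʳ j))

-- For an involution y let ψ(y) = ℓ(y) + (number of 2-cycles of y). If v = v′s with ℓ(v) = ℓ(v′) + 1,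
-- associativity of ∘ gives v⁻¹ ∘ v = s ∘ (v′⁻¹ ∘ v′) ∘ s, and s ∘ y ∘ s is either y or the twisted
-- conjugate s ⋉ y, with ψ(s ⋉ y) = ψ(y) + 2. Hence ψ(v⁻¹ ∘ v) ≤ 2ℓ(v), and peeling descents s ↦ s ⋉ x
-- off x shows that equality is attained. So 𝒜(x) is the set of atoms, the v with v⁻¹ ∘ v = x and
-- 2ℓ(v) = ψ(x), and every atom other than 1 is v′s for a descent s of x and an atom v′ of s ⋉ x.
-- If x avoids 321, no two descents of x are adjacent, distant ones commute (also under ⋉), and
-- induction on ψ gives a unique atom. If x contains 321, either some descent s leaves a 321 in s ⋉ x,
-- to which uniqueness descends, or x acts on three consecutive points as (p p+2), and its two reduced
-- words s₁s₂s₁ = s₂s₁s₂ give two distinct atoms.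
module Submission where

open import Defs
open import Data.Nat using (ℕ)
open import Function.Bundles using (_⇔_)
open import Function.Bundles using (mk⇔)
open import Data.Nat as ℕ using (zero; suc; _+_; _*_; z≤n; s≤s)
import Data.Nat.Properties as ℕP
open import Data.Nat.ListAction using () renaming (sum to sumˡ)
open import Data.Nat.ListAction.Properties using (sum-++)
open import Data.Fin as F using (Fin; toℕ; fromℕ<)
import Data.Fin.Properties as FP
open import Data.Fin.Permutation as P using (_⟨$⟩ʳ_; _⟨$⟩ˡ_; _≈_)
open import Data.List as L using (List; []; _∷_; length; filter; allFin; concatMap; map; _++_)
import Data.List.Properties as LP
open import Data.Product using (Σ; Σ-syntax; _×_; _,_; proj₁; proj₂)
open import Data.Sum using (_⊎_; inj₁; inj₂; [_,_])
open import Data.Empty using (⊥; ⊥-elim)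
open import Data.Bool using (Bool; true; false)
open import Function.Base using (_∘_)
open import Function.Construct.Composition using (_⇔-∘_)
open import Relation.Nullary using (¬_; Dec; yes; no; does)
open import Relation.Nullary.Decidable using (_×-dec_; _⊎-dec_; dec-true; dec-false; decidable-stable)
import Relation.Unary as U
open import Relation.Binary using (Setoid; tri<; tri≈; tri>)
open import Relation.Binary.PropositionalEquality hiding ([_])
open import Algebra.Properties.CommutativeMonoid.Sum ℕP.+-0-commutativeMonoid
  using (sum; ∑-comm; ∑-permute; sum-cong-≗; ∑-distrib-+; sum-replicate-zero)

private variable
  n : ℕ

𝟙 : ∀ {p} {P : Set p} → Dec P → ℕ
𝟙 (yes _) = 1
𝟙 (no _)  = 0

𝟙-yes : ∀ {p} {P : Set p} → P → (d : Dec P) → 𝟙 d ≡ 1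
𝟙-yes p (yes _) = refl
𝟙-yes p (no ¬p) = ⊥-elim (¬p p)

𝟙-no : ∀ {p} {P : Set p} → ¬ P → (d : Dec P) → 𝟙 d ≡ 0
𝟙-no ¬p (yes p) = ⊥-elim (¬p p)
𝟙-no ¬p (no _)  = refl

𝟙-cong : ∀ {p q} {P : Set p} {Q : Set q} → (P → Q) → (Q → P) → (p? : Dec P) (q? : Dec Q) → 𝟙 p? ≡ 𝟙 q?
𝟙-cong f g (yes p) q? = sym (𝟙-yes (f p) q?)
𝟙-cong f g (no ¬p) q? = sym (𝟙-no (¬p ∘ g) q?)

does-cong : ∀ {p q} {P : Set p} {Q : Set q} (p? : Dec P) (q? : Dec Q) → (P → Q) → (Q → P) → does p? ≡ does q?
does-cong (yes p) (yes q) f g = refl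
does-cong (yes p) (no ¬q) f g = ⊥-elim (¬q (f p))
does-cong (no ¬p) (yes q) f g = ⊥-elim (¬p (g q))
does-cong (no ¬p) (no ¬q) f g = refl

length-filter-filter : ∀ {A : Set} {P Q : A → Set} (P? : U.Decidable P) (Q? : U.Decidable Q) xs →
  length (filter P? (filter Q? xs)) ≡ sumˡ (map (λ x → 𝟙 (Q? x ×-dec P? x)) xs)
length-filter-filter P? Q? [] = refl
length-filter-filter P? Q? (x ∷ xs) with Q? x
... | no _ = length-filter-filter P? Q? xs
... | yes _ with P? x
...   | yes _ = cong suc (length-filter-filter P? Q? xs)
...   | no _  = length-filter-filter P? Q? xs

sum-concatMap : ∀ {A B : Set} (h : B → ℕ) (f : A → List B) xs →
  sumˡ (map h (concatMap f xs)) ≡ sumˡ (map (λ x → sumˡ (map h (f x))) xs)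
sum-concatMap h f [] = refl
sum-concatMap h f (x ∷ xs) = begin
  sumˡ (map h (f x ++ concatMap f xs))                   ≡⟨ cong sumˡ (LP.map-++ h (f x) _) ⟩
  sumˡ (map h (f x) ++ map h (concatMap f xs))           ≡⟨ sum-++ (map h (f x)) _ ⟩
  sumˡ (map h (f x)) + sumˡ (map h (concatMap f xs))     ≡⟨ cong (sumˡ (map h (f x)) +_) (sum-concatMap h f xs) ⟩
  sumˡ (map h (f x)) + sumˡ (map (λ y → sumˡ (map h (f y))) xs) ∎
  where open ≡-Reasoning

sum-map-tabulate : {B : Set} (h : B → ℕ) (t : Fin n → B) → sumˡ (map h (L.tabulate t)) ≡ sum (h ∘ t)
sum-map-tabulate {zero}  h t = refl
sum-map-tabulate {suc n} h t = cong (h (t F.zero) +_) (sum-map-tabulate h (t ∘ F.suc))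

∑∑ : (Fin n → Fin n → ℕ) → ℕ
∑∑ F = sum λ i → sum λ j → F i j

∑∑-cong : {F G : Fin n → Fin n → ℕ} → (∀ i j → F i j ≡ G i j) → ∑∑ F ≡ ∑∑ G
∑∑-cong e = sum-cong-≗ λ i → sum-cong-≗ (e i)

∑∑-+ : (F G : Fin n → Fin n → ℕ) → ∑∑ (λ i j → F i j + G i j) ≡ ∑∑ F + ∑∑ G
∑∑-+ F G = trans (sum-cong-≗ λ i → ∑-distrib-+ (F i) (G i)) (∑-distrib-+ (λ i → sum (F i)) (λ i → sum (G i)))

∑∑-permute : (F : Fin n → Fin n → ℕ) (π : S n) → ∑∑ F ≡ ∑∑ (λ i j → F (π ⟨$⟩ʳ i) (π ⟨$⟩ʳ j))
∑∑-permute F π = trans (∑-permute (λ i → sum (F i)) π) (sum-cong-≗ λ i → ∑-permute (F (π ⟨$⟩ʳ i)) π)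

∑∑-0 : {F : Fin n → Fin n → ℕ} → (∀ i j → F i j ≡ 0) → ∑∑ F ≡ 0
∑∑-0 {n} {F} e = begin
  ∑∑ F                 ≡⟨ ∑∑-cong e ⟩
  ∑∑ {n} (λ _ _ → 0)   ≡⟨ sum-cong-≗ {n} (λ _ → sum-replicate-zero n) ⟩
  sum {n} (λ _ → 0)    ≡⟨ sum-replicate-zero n ⟩
  0                    ∎
  where open ≡-Reasoning

δ : Fin n → Fin n → ℕ
δ k i = 𝟙 (i FP.≟ k)

∑-δ : (k : Fin n) (g : Fin n → ℕ) → sum (λ j → δ k j * g j) ≡ g k
∑-δ {suc n} F.zero g = begin
  g F.zero + 0 + sum (λ j → δ F.zero (F.suc j) * g (F.suc j))
    ≡⟨ cong (g F.zero + 0 +_) (trans (sum-cong-≗ λ j → cong (_* g (F.suc j)) (𝟙-no (λ ()) (F.suc j FP.≟ F.zero)))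
                                     (sum-replicate-zero n)) ⟩
  g F.zero + 0 + 0
    ≡⟨ trans (ℕP.+-identityʳ _) (ℕP.+-identityʳ _) ⟩
  g F.zero ∎
  where open ≡-Reasoning
∑-δ {suc n} (F.suc k) g = begin
  δ (F.suc k) F.zero * g F.zero + sum (λ j → δ (F.suc k) (F.suc j) * g (F.suc j))
    ≡⟨ cong₂ _+_ (cong (_* g F.zero) (𝟙-no (λ ()) (F.zero FP.≟ F.suc k)))
                 (sum-cong-≗ λ j → cong (_* g (F.suc j))
                   (𝟙-cong FP.suc-injective (cong F.suc) (F.suc j FP.≟ F.suc k) (j FP.≟ k))) ⟩
  sum (λ j → δ k j * g (F.suc j))
    ≡⟨ ∑-δ k (g ∘ F.suc) ⟩
  g (F.suc k) ∎
  where open ≡-Reasoning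

pointMass : Fin n → Fin n → ℕ → Fin n → Fin n → ℕ
pointMass k₁ k₂ c i j = δ k₂ j * (δ k₁ i * c)

∑∑-pointMass : (k₁ k₂ : Fin n) (c : ℕ) → ∑∑ (pointMass k₁ k₂ c) ≡ c
∑∑-pointMass k₁ k₂ c = trans (sum-cong-≗ λ i → ∑-δ k₂ (λ _ → δ k₁ i * c)) (∑-δ k₁ (λ _ → c))

pointMass-at : (k₁ k₂ : Fin n) (c : ℕ) → pointMass k₁ k₂ c k₁ k₂ ≡ c
pointMass-at k₁ k₂ c rewrite 𝟙-yes refl (k₂ FP.≟ k₂) | 𝟙-yes refl (k₁ FP.≟ k₁) =
  trans (ℕP.*-identityˡ (1 * c)) (ℕP.*-identityˡ c)

pointMass-off : (k₁ k₂ : Fin n) (c : ℕ) (i j : Fin n) → ¬ (i ≡ k₁ × j ≡ k₂) → pointMass k₁ k₂ c i j ≡ 0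
pointMass-off k₁ k₂ c i j ne with j FP.≟ k₂ | i FP.≟ k₁
... | no _  | _     = refl
... | yes _ | no _  = refl
... | yes e | yes e′ = ⊥-elim (ne (e′ , e))

lo hi : Gen n → Fin n
lo (i , _) = i
hi (_ , p) = fromℕ< p

toℕ-hi : (g : Gen n) → toℕ (hi g) ≡ suc (toℕ (lo g))
toℕ-hi (_ , p) = FP.toℕ-fromℕ< p

lo<hi : (g : Gen n) → lo g F.< hi g
lo<hi g = subst (toℕ (lo g) ℕ.<_) (sym (toℕ-hi g)) (ℕP.n<1+n _)

<⇒≢ : {i j : Fin n} → i F.< j → i ≢ j
<⇒≢ i<j refl = ℕP.<-irrefl refl i<j

lo≢hi : (g : Gen n) → lo g ≢ hi g
lo≢hi g = <⇒≢ (lo<hi g)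

lo<⇒hi< : (g : Gen n) {k : Fin n} → k ≢ hi g → lo g F.< k → hi g F.< k
lo<⇒hi< g {k} k≢hi lo<k = subst (ℕ._< toℕ k) (sym (toℕ-hi g))
  (ℕP.≤∧≢⇒< lo<k λ e → k≢hi (FP.toℕ-injective (trans (sym e) (sym (toℕ-hi g)))))

<hi⇒<lo : (g : Gen n) {k : Fin n} → k ≢ lo g → k F.< hi g → k F.< lo g
<hi⇒<lo g {k} k≢lo k<hi =
  ℕP.≤∧≢⇒< (ℕP.<⇒≤pred (subst (toℕ k ℕ.<_) (toℕ-hi g) k<hi)) (k≢lo ∘ FP.toℕ-injective)

≢⇒<⊎> : {i j : Fin n} → i ≢ j → i F.< j ⊎ j F.< i
≢⇒<⊎> {i = i} {j} i≢j with ℕP.<-cmp (toℕ i) (toℕ j)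
... | tri< i<j _ _ = inj₁ i<j
... | tri≈ _ e _   = ⊥-elim (i≢j (FP.toℕ-injective e))
... | tri> _ _ j<i = inj₂ j<i

σ : Gen n → Fin n → Fin n
σ g k = s g ⟨$⟩ʳ k

data Position (g : Gen n) (k : Fin n) : Set where
  at-lo     : k ≡ lo g → Position g k
  at-hi     : k ≡ hi g → Position g k
  elsewhere : k ≢ lo g → k ≢ hi g → Position g k

position : (g : Gen n) (k : Fin n) → Position g k
position g k with k FP.≟ lo g | k FP.≟ hi g
... | yes e   | _       = at-lo e
... | no _    | yes e   = at-hi e
... | no k≢lo | no k≢hi = elsewhere k≢lo k≢hi

σ-lo : (g : Gen n) → σ g (lo g) ≡ hi g
σ-lo g rewrite dec-true (lo g FP.≟ lo g) refl = refl

σ-hi : (g : Gen n) → σ g (hi g) ≡ lo g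
σ-hi g rewrite dec-false (hi g FP.≟ lo g) (lo≢hi g ∘ sym) | dec-true (hi g FP.≟ hi g) refl = refl

σ-elsewhere : (g : Gen n) {k : Fin n} → k ≢ lo g → k ≢ hi g → σ g k ≡ k
σ-elsewhere g {k} k≢lo k≢hi rewrite dec-false (k FP.≟ lo g) k≢lo | dec-false (k FP.≟ hi g) k≢hi = refl

σ-below : (g : Gen n) {k : Fin n} → k F.< lo g → σ g k ≡ k
σ-below g k<lo = σ-elsewhere g (<⇒≢ k<lo) (<⇒≢ (ℕP.<-trans k<lo (lo<hi g)))

σ-above : (g : Gen n) {k : Fin n} → hi g F.< k → σ g k ≡ k
σ-above g hi<k = σ-elsewhere g (<⇒≢ (ℕP.<-trans (lo<hi g) hi<k) ∘ sym) (<⇒≢ hi<k ∘ sym)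

σ-involutive : (g : Gen n) (k : Fin n) → σ g (σ g k) ≡ k
σ-involutive g k with position g k
... | at-lo refl = trans (cong (σ g) (σ-lo g)) (σ-hi g)
... | at-hi refl = trans (cong (σ g) (σ-hi g)) (σ-lo g)
... | elsewhere k≢lo k≢hi = trans (cong (σ g) (σ-elsewhere g k≢lo k≢hi)) (σ-elsewhere g k≢lo k≢hi)

σ-mono : (g : Gen n) {i j : Fin n} → i F.< j → ¬ (i ≡ lo g × j ≡ hi g) → σ g i F.< σ g j
σ-mono g {i} {j} i<j not-g with position g i | position g j
... | at-lo refl | at-lo refl = ⊥-elim (<⇒≢ i<j refl)
... | at-lo refl | at-hi refl = ⊥-elim (not-g (refl , refl))
... | at-lo refl | elsewhere j≢lo j≢hi rewrite σ-lo g | σ-elsewhere g j≢lo j≢hi = lo<⇒hi< g j≢hi i<j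
... | at-hi refl | at-lo refl = ⊥-elim (ℕP.<-asym i<j (lo<hi g))
... | at-hi refl | at-hi refl = ⊥-elim (<⇒≢ i<j refl)
... | at-hi refl | elsewhere j≢lo j≢hi rewrite σ-hi g | σ-elsewhere g j≢lo j≢hi = ℕP.<-trans (lo<hi g) i<j
... | elsewhere i≢lo i≢hi | at-lo refl rewrite σ-lo g | σ-elsewhere g i≢lo i≢hi = ℕP.<-trans i<j (lo<hi g)
... | elsewhere i≢lo i≢hi | at-hi refl rewrite σ-hi g | σ-elsewhere g i≢lo i≢hi = <hi⇒<lo g i≢lo i<j
... | elsewhere i≢lo i≢hi | elsewhere j≢lo j≢hi rewrite σ-elsewhere g i≢lo i≢hi | σ-elsewhere g j≢lo j≢hi = i<j

σ-mono⁻ : (g : Gen n) {i j : Fin n} → σ g i F.< σ g j → ¬ (i ≡ hi g × j ≡ lo g) → i F.< j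
σ-mono⁻ g {i} {j} σi<σj not-g = subst₂ F._<_ (σ-involutive g i) (σ-involutive g j) (σ-mono g σi<σj not-σg)
  where
    not-σg : ¬ (σ g i ≡ lo g × σ g j ≡ hi g)
    not-σg (e₁ , e₂) = not-g ( trans (sym (σ-involutive g i)) (trans (cong (σ g) e₁) (σ-lo g))
                             , trans (sym (σ-involutive g j)) (trans (cong (σ g) e₂) (σ-hi g)))

s⁻¹-apply : (g : Gen n) (k : Fin n) → s g ⟨$⟩ˡ k ≡ σ g k
s⁻¹-apply g k = trans (cong (s g ⟨$⟩ˡ_) (sym (σ-involutive g k))) (P.inverseˡ (s g))

-- Wrapping _≈_ in a record lets Agda infer the two permutations from a proof.
infix 4 _≃_
record _≃_ (u v : S n) : Set where
  constructor mk≃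
  field app : u ≈ v
open _≃_ public

≃-refl : {u : S n} → u ≃ u
≃-refl = mk≃ λ _ → refl

≃-sym : {u v : S n} → u ≃ v → v ≃ u
≃-sym (mk≃ e) = mk≃ λ i → sym (e i)

≃-trans : {u v w : S n} → u ≃ v → v ≃ w → u ≃ w
≃-trans (mk≃ e) (mk≃ f) = mk≃ λ i → trans (e i) (f i)

≃-setoid : ℕ → Setoid _ _
≃-setoid n = record
  { Carrier = S n ; _≈_ = _≃_
  ; isEquivalence = record { refl = ≃-refl ; sym = ≃-sym ; trans = ≃-trans } }

module ≃-Reasoning {n : ℕ} where
  open import Relation.Binary.Reasoning.Setoid (≃-setoid n) public

·-cong : {u u′ v v′ : S n} → u ≃ u′ → v ≃ v′ → u · v ≃ u′ · v′
·-cong {u = u} (mk≃ e) (mk≃ f) = mk≃ λ i → trans (cong (u ⟨$⟩ʳ_) (f i)) (e _)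

·-congʳ : {u u′ : S n} (v : S n) → u ≃ u′ → u · v ≃ u′ · v
·-congʳ {u = u} {u′} v e = ·-cong {u = u} {u′} {v} {v} e ≃-refl

·-congˡ : (u : S n) {v v′ : S n} → v ≃ v′ → u · v ≃ u · v′
·-congˡ u {v} {v′} e = ·-cong {u = u} {u} {v} {v′} ≃-refl e

⟨$⟩ʳ⇒⟨$⟩ˡ : (w : S n) {j k : Fin n} → w ⟨$⟩ʳ j ≡ k → w ⟨$⟩ˡ k ≡ j
⟨$⟩ʳ⇒⟨$⟩ˡ w refl = P.inverseˡ w

⟨$⟩ˡ⇒⟨$⟩ʳ : (w : S n) {j k : Fin n} → w ⟨$⟩ˡ k ≡ j → w ⟨$⟩ʳ j ≡ k
⟨$⟩ˡ⇒⟨$⟩ʳ w refl = P.inverseʳ w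

⟨$⟩ʳ-injective : (w : S n) {i j : Fin n} → w ⟨$⟩ʳ i ≡ w ⟨$⟩ʳ j → i ≡ j
⟨$⟩ʳ-injective w e = trans (sym (P.inverseˡ w)) (⟨$⟩ʳ⇒⟨$⟩ˡ w (sym e))

⁻¹-cong : {u v : S n} → u ≃ v → u ⁻¹ ≃ v ⁻¹
⁻¹-cong {u = u} {v} (mk≃ e) = mk≃ λ i → ⟨$⟩ʳ⇒⟨$⟩ˡ u (trans (e _) (P.inverseʳ v))

⁻¹≃id : {v : S n} → v ⁻¹ ≃ P.id → v ≃ P.id
⁻¹≃id {v = v} (mk≃ e) = mk≃ λ i → ⟨$⟩ˡ⇒⟨$⟩ʳ v (e i)

·s·s : (g : Gen n) (w : S n) → w · s g · s g ≃ w
·s·s g w = mk≃ λ i → cong (w ⟨$⟩ʳ_) (σ-involutive g i)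

s·s· : (g : Gen n) (w : S n) → s g · (s g · w) ≃ w
s·s· g w = mk≃ λ i → σ-involutive g _

⁻¹-·s : (g : Gen n) (v : S n) → (v · s g) ⁻¹ ≃ s g · v ⁻¹
⁻¹-·s g v = mk≃ λ i → s⁻¹-apply g (v ⟨$⟩ˡ i)

inversion𝟙 : (Fin n → Fin n) → Fin n → Fin n → ℕ
inversion𝟙 f i j = 𝟙 ((i FP.<? j) ×-dec (f j FP.<? f i))

#inv : (Fin n → Fin n) → ℕ
#inv f = ∑∑ (inversion𝟙 f)

ℓ≡#inv : (w : S n) → ℓ w ≡ #inv (w ⟨$⟩ʳ_)
ℓ≡#inv {n} w = begin
  ℓ w
    ≡⟨ length-filter-filter _ _ (concatMap row (allFin n)) ⟩
  sumˡ (map h (concatMap row (allFin n)))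
    ≡⟨ sum-concatMap h row (allFin n) ⟩
  sumˡ (map (λ i → sumˡ (map h (row i))) (allFin n))
    ≡⟨ cong sumˡ (LP.map-cong (λ i → cong sumˡ (sym (LP.map-∘ (allFin n)))) (allFin n)) ⟩
  sumˡ (map (λ i → sumˡ (map (λ j → h (i , j)) (allFin n))) (allFin n))
    ≡⟨ sum-map-tabulate (λ i → sumˡ (map (λ j → h (i , j)) (allFin n))) (λ i → i) ⟩
  sum (λ i → sumˡ (map (λ j → h (i , j)) (allFin n)))
    ≡⟨ sum-cong-≗ (λ i → sum-map-tabulate (λ j → h (i , j)) (λ j → j)) ⟩
  #inv (w ⟨$⟩ʳ_) ∎
  where
    open ≡-Reasoning
    row : Fin n → List (Fin n × Fin n)
    row i = map (i ,_) (allFin n)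
    h : Fin n × Fin n → ℕ
    h (i , j) = inversion𝟙 (w ⟨$⟩ʳ_) i j

#inv-cong : {f f′ : Fin n → Fin n} → (∀ i → f i ≡ f′ i) → #inv f ≡ #inv f′
#inv-cong {f′ = f′} e = ∑∑-cong {G = inversion𝟙 f′} λ i j →
  𝟙-cong (λ (i<j , fj<fi) → i<j , subst₂ F._<_ (e j) (e i) fj<fi)
         (λ (i<j , fj<fi) → i<j , subst₂ F._<_ (sym (e j)) (sym (e i)) fj<fi) _ _

#inv-inverse : (w : S n) → #inv (w ⟨$⟩ˡ_) ≡ #inv (w ⟨$⟩ʳ_)
#inv-inverse w = begin
  #inv (w ⟨$⟩ˡ_)
    ≡⟨ ∑∑-permute _ w ⟩
  ∑∑ (λ i j → inversion𝟙 (w ⟨$⟩ˡ_) (w ⟨$⟩ʳ i) (w ⟨$⟩ʳ j))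
    ≡⟨ ∑∑-cong {G = λ i j → inversion𝟙 (w ⟨$⟩ʳ_) j i} (λ i j → 𝟙-cong
         (λ (a , b) → subst₂ F._<_ (P.inverseˡ w) (P.inverseˡ w) b , a)
         (λ (a , b) → b , subst₂ F._<_ (sym (P.inverseˡ w)) (sym (P.inverseˡ w)) a) _ _) ⟩
  ∑∑ (λ i j → inversion𝟙 (w ⟨$⟩ʳ_) j i)
    ≡⟨ ∑-comm (λ i j → inversion𝟙 (w ⟨$⟩ʳ_) j i) ⟩
  #inv (w ⟨$⟩ʳ_) ∎
  where open ≡-Reasoning

-- Relabelling both positions by σ g preserves whether (i , j) is an inversion, except for the
-- pairs (lo g , hi g) and (hi g , lo g), which trade places.
inversion𝟙-σ : (f : Fin n → Fin n) (g : Gen n) (i j : Fin n) →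
  𝟙 ((σ g i FP.<? σ g j) ×-dec (f j FP.<? f i)) + pointMass (lo g) (hi g) (𝟙 (f (hi g) FP.<? f (lo g))) i j
  ≡ inversion𝟙 f i j + pointMass (hi g) (lo g) (𝟙 (f (lo g) FP.<? f (hi g))) i j
inversion𝟙-σ {n} f g i j = by-cases i j ((i FP.≟ lo g) ×-dec (j FP.≟ hi g)) ((i FP.≟ hi g) ×-dec (j FP.≟ lo g))
  where
    open ≡-Reasoning
    c₁ = 𝟙 (f (hi g) FP.<? f (lo g))
    c₂ = 𝟙 (f (lo g) FP.<? f (hi g))
    N : Fin n → Fin n → ℕ
    N i j = 𝟙 ((σ g i FP.<? σ g j) ×-dec (f j FP.<? f i))
    by-cases : ∀ i j → Dec (i ≡ lo g × j ≡ hi g) → Dec (i ≡ hi g × j ≡ lo g) →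
      N i j + pointMass (lo g) (hi g) c₁ i j ≡ inversion𝟙 f i j + pointMass (hi g) (lo g) c₂ i j
    by-cases i j (yes (refl , refl)) _ = begin
      N (lo g) (hi g) + pointMass (lo g) (hi g) c₁ (lo g) (hi g)
        ≡⟨ cong₂ _+_ (𝟙-no (λ (a , _) → ℕP.<-asym (subst₂ F._<_ (σ-lo g) (σ-hi g) a) (lo<hi g)) _)
                     (pointMass-at (lo g) (hi g) c₁) ⟩
      c₁
        ≡⟨ 𝟙-cong (lo<hi g ,_) proj₂ _ _ ⟩
      inversion𝟙 f (lo g) (hi g)
        ≡⟨ sym (ℕP.+-identityʳ _) ⟩
      inversion𝟙 f (lo g) (hi g) + 0
        ≡⟨ cong (inversion𝟙 f (lo g) (hi g) +_)
             (sym (pointMass-off (hi g) (lo g) c₂ (lo g) (hi g) (lo≢hi g ∘ proj₁))) ⟩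
      inversion𝟙 f (lo g) (hi g) + pointMass (hi g) (lo g) c₂ (lo g) (hi g) ∎
    by-cases i j (no _) (yes (refl , refl)) = begin
      N (hi g) (lo g) + pointMass (lo g) (hi g) c₁ (hi g) (lo g)
        ≡⟨ cong (N (hi g) (lo g) +_) (pointMass-off (lo g) (hi g) c₁ (hi g) (lo g) (lo≢hi g ∘ sym ∘ proj₁)) ⟩
      N (hi g) (lo g) + 0
        ≡⟨ ℕP.+-identityʳ _ ⟩
      N (hi g) (lo g)
        ≡⟨ 𝟙-cong proj₂ (subst₂ F._<_ (sym (σ-hi g)) (sym (σ-lo g)) (lo<hi g) ,_) _ _ ⟩
      c₂
        ≡⟨ sym (pointMass-at (hi g) (lo g) c₂) ⟩
      pointMass (hi g) (lo g) c₂ (hi g) (lo g)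
        ≡⟨ cong (_+ pointMass (hi g) (lo g) c₂ (hi g) (lo g)) (sym (𝟙-no (λ (a , _) → ℕP.<-asym a (lo<hi g)) _)) ⟩
      inversion𝟙 f (hi g) (lo g) + pointMass (hi g) (lo g) c₂ (hi g) (lo g) ∎
    by-cases i j (no ≠g) (no ≠g⁻¹) = cong₂ _+_
          (𝟙-cong (λ (a , b) → σ-mono⁻ g a ≠g⁻¹ , b) (λ (a , b) → σ-mono g a ≠g , b) _ _)
          (trans (pointMass-off (lo g) (hi g) c₁ i j ≠g) (sym (pointMass-off (hi g) (lo g) c₂ i j ≠g⁻¹)))

#inv-∘σ : (f : Fin n → Fin n) (g : Gen n) →
  #inv (f ∘ σ g) + 𝟙 (f (hi g) FP.<? f (lo g)) ≡ #inv f + 𝟙 (f (lo g) FP.<? f (hi g))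
#inv-∘σ {n} f g = begin
  #inv (f ∘ σ g) + c₁
    ≡⟨ cong (_+ c₁) (∑∑-permute _ (s g)) ⟩
  ∑∑ (λ i j → inversion𝟙 (f ∘ σ g) (σ g i) (σ g j)) + c₁
    ≡⟨ cong (_+ c₁) (∑∑-cong {G = N} λ i j → 𝟙-cong
          (λ (a , b) → a , subst₂ F._<_ (cong f (σ-involutive g j)) (cong f (σ-involutive g i)) b)
          (λ (a , b) → a , subst₂ F._<_ (cong f (sym (σ-involutive g j))) (cong f (sym (σ-involutive g i))) b) _ _) ⟩
  ∑∑ N + c₁
    ≡⟨ cong (∑∑ N +_) (sym (∑∑-pointMass (lo g) (hi g) c₁)) ⟩
  ∑∑ N + ∑∑ (pointMass (lo g) (hi g) c₁)
    ≡⟨ sym (∑∑-+ N _) ⟩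
  ∑∑ (λ i j → N i j + pointMass (lo g) (hi g) c₁ i j)
    ≡⟨ ∑∑-cong (inversion𝟙-σ f g) ⟩
  ∑∑ (λ i j → inversion𝟙 f i j + pointMass (hi g) (lo g) c₂ i j)
    ≡⟨ ∑∑-+ (inversion𝟙 f) _ ⟩
  #inv f + ∑∑ (pointMass (hi g) (lo g) c₂)
    ≡⟨ cong (#inv f +_) (∑∑-pointMass (hi g) (lo g) c₂) ⟩
  #inv f + c₂ ∎
  where
    open ≡-Reasoning
    c₁ = 𝟙 (f (hi g) FP.<? f (lo g))
    c₂ = 𝟙 (f (lo g) FP.<? f (hi g))
    N : Fin n → Fin n → ℕ
    N i j = 𝟙 ((σ g i FP.<? σ g j) ×-dec (f j FP.<? f i))

ℓ-cong : {u v : S n} → u ≃ v → ℓ u ≡ ℓ v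
ℓ-cong {u = u} {v} (mk≃ e) = trans (ℓ≡#inv u) (trans (#inv-cong e) (sym (ℓ≡#inv v)))

ℓ-⁻¹ : (w : S n) → ℓ (w ⁻¹) ≡ ℓ w
ℓ-⁻¹ w = trans (ℓ≡#inv (w ⁻¹)) (trans (#inv-inverse w) (sym (ℓ≡#inv w)))

ℓ-id : ℓ (P.id {n}) ≡ 0
ℓ-id {n} = trans (ℓ≡#inv (P.id {n}))
  (∑∑-0 {F = inversion𝟙 (P.id {n} ⟨$⟩ʳ_)} λ i j → 𝟙-no (λ (i<j , j<i) → ℕP.<-asym i<j j<i) _)

Ascentʳ : Gen n → S n → Set
Ascentʳ g w = w ⟨$⟩ʳ lo g F.< w ⟨$⟩ʳ hi g

Ascentˡ : Gen n → S n → Set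
Ascentˡ g w = Ascentʳ g (w ⁻¹)

ascentʳ? : (g : Gen n) (w : S n) → Dec (Ascentʳ g w)
ascentʳ? g w = w ⟨$⟩ʳ lo g FP.<? w ⟨$⟩ʳ hi g

ascentˡ? : (g : Gen n) (w : S n) → Dec (Ascentˡ g w)
ascentˡ? g w = ascentʳ? g (w ⁻¹)

¬ascent⇒descent : (g : Gen n) (w : S n) → ¬ Ascentʳ g w → w ⟨$⟩ʳ hi g F.< w ⟨$⟩ʳ lo g
¬ascent⇒descent g w ¬asc with ≢⇒<⊎> (lo≢hi g ∘ ⟨$⟩ʳ-injective w)
... | inj₁ asc  = ⊥-elim (¬asc asc)
... | inj₂ desc = desc

Ascentʳ-cong : (g : Gen n) {w w′ : S n} → w ≃ w′ → Ascentʳ g w → Ascentʳ g w′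
Ascentʳ-cong g (mk≃ e) = subst₂ F._<_ (e (lo g)) (e (hi g))

Ascentˡ-cong : (g : Gen n) {w w′ : S n} → w ≃ w′ → Ascentˡ g w → Ascentˡ g w′
Ascentˡ-cong g e = Ascentʳ-cong g (⁻¹-cong e)

ℓ-·s : (g : Gen n) (w : S n) →
  ℓ (w · s g) + 𝟙 (w ⟨$⟩ʳ hi g FP.<? w ⟨$⟩ʳ lo g) ≡ ℓ w + 𝟙 (ascentʳ? g w)
ℓ-·s g w = begin
  ℓ (w · s g) + 𝟙 (w ⟨$⟩ʳ hi g FP.<? w ⟨$⟩ʳ lo g)        ≡⟨ cong (_+ c) (ℓ≡#inv (w · s g)) ⟩
  #inv ((w ⟨$⟩ʳ_) ∘ σ g) + 𝟙 (w ⟨$⟩ʳ hi g FP.<? w ⟨$⟩ʳ lo g) ≡⟨ #inv-∘σ (w ⟨$⟩ʳ_) g ⟩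
  #inv (w ⟨$⟩ʳ_) + 𝟙 (ascentʳ? g w)                      ≡⟨ cong (_+ 𝟙 (ascentʳ? g w)) (sym (ℓ≡#inv w)) ⟩
  ℓ w + 𝟙 (ascentʳ? g w) ∎
  where
    open ≡-Reasoning
    c = 𝟙 (w ⟨$⟩ʳ hi g FP.<? w ⟨$⟩ʳ lo g)

ℓ-·s-ascent : (g : Gen n) (w : S n) → Ascentʳ g w → ℓ (w · s g) ≡ suc (ℓ w)
ℓ-·s-ascent g w asc with ℓ-·s g w
... | e rewrite 𝟙-no (ℕP.<-asym asc) (w ⟨$⟩ʳ hi g FP.<? w ⟨$⟩ʳ lo g) | 𝟙-yes asc (ascentʳ? g w) =
  trans (sym (ℕP.+-identityʳ _)) (trans e (ℕP.+-comm (ℓ w) 1))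

ℓ-·s-descent : (g : Gen n) (w : S n) → ¬ Ascentʳ g w → suc (ℓ (w · s g)) ≡ ℓ w
ℓ-·s-descent g w ¬asc with ℓ-·s g w
... | e rewrite 𝟙-yes (¬ascent⇒descent g w ¬asc) (w ⟨$⟩ʳ hi g FP.<? w ⟨$⟩ʳ lo g) | 𝟙-no ¬asc (ascentʳ? g w) =
  trans (ℕP.+-comm 1 _) (trans e (ℕP.+-identityʳ (ℓ w)))

⁻¹-s· : (g : Gen n) (w : S n) → (s g · w) ⁻¹ ≃ w ⁻¹ · s g
⁻¹-s· g w = mk≃ λ i → cong (w ⟨$⟩ˡ_) (s⁻¹-apply g i)

ℓ-s·-via-⁻¹ : (g : Gen n) (w : S n) → ℓ (s g · w) ≡ ℓ (w ⁻¹ · s g)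
ℓ-s·-via-⁻¹ g w = trans (sym (ℓ-⁻¹ (s g · w))) (ℓ-cong (⁻¹-s· g w))

ℓ-s·-ascent : (g : Gen n) (w : S n) → Ascentˡ g w → ℓ (s g · w) ≡ suc (ℓ w)
ℓ-s·-ascent g w asc = trans (ℓ-s·-via-⁻¹ g w) (trans (ℓ-·s-ascent g (w ⁻¹) asc) (cong suc (ℓ-⁻¹ w)))

ℓ-s·-descent : (g : Gen n) (w : S n) → ¬ Ascentˡ g w → suc (ℓ (s g · w)) ≡ ℓ w
ℓ-s·-descent g w ¬asc = trans (cong suc (ℓ-s·-via-⁻¹ g w)) (trans (ℓ-·s-descent g (w ⁻¹) ¬asc) (ℓ-⁻¹ w))

ℓ-s·-≤ : (g : Gen n) (w : S n) → ℓ (s g · w) ℕ.≤ suc (ℓ w)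
ℓ-s·-≤ g w with ascentˡ? g w
... | yes asc = ℕP.≤-reflexive (ℓ-s·-ascent g w asc)
... | no ¬asc = ℕP.≤-trans (ℕP.n≤1+n _) (ℕP.≤-trans (ℕP.≤-reflexive (ℓ-s·-descent g w ¬asc)) (ℕP.n≤1+n _))

s·ᵇ : Bool → Gen n → S n → S n
s·ᵇ true  g w = s g · w
s·ᵇ false g w = w

·sᵇ : Bool → S n → Gen n → S n
·sᵇ true  w g = w · s g
·sᵇ false w g = w

-- g ⊳ w and w ⊲ g are the Demazure products s_g ∘ w and w ∘ s_g.
infixr 6 _⊳_
infixl 7 _⊲_

_⊳_ : Gen n → S n → S n
g ⊳ w = s·ᵇ (does (ascentˡ? g w)) g w

_⊲_ : S n → Gen n → S n
w ⊲ g = ·sᵇ (does (ascentʳ? g w)) w g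

⊳-ascent : (g : Gen n) (w : S n) → Ascentˡ g w → g ⊳ w ≃ s g · w
⊳-ascent g w asc rewrite dec-true (ascentˡ? g w) asc = ≃-refl

⊳-descent : (g : Gen n) (w : S n) → ¬ Ascentˡ g w → g ⊳ w ≃ w
⊳-descent g w ¬asc rewrite dec-false (ascentˡ? g w) ¬asc = ≃-refl

⊲-ascent : (g : Gen n) (w : S n) → Ascentʳ g w → w ⊲ g ≃ w · s g
⊲-ascent g w asc rewrite dec-true (ascentʳ? g w) asc = ≃-refl

⊲-descent : (g : Gen n) (w : S n) → ¬ Ascentʳ g w → w ⊲ g ≃ w
⊲-descent g w ¬asc rewrite dec-false (ascentʳ? g w) ¬asc = ≃-refl

s·ᵇ-cong : (b : Bool) (g : Gen n) {w w′ : S n} → w ≃ w′ → s·ᵇ b g w ≃ s·ᵇ b g w′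
s·ᵇ-cong true  g e = ·-congˡ (s g) e
s·ᵇ-cong false g e = e

·sᵇ-cong : (b : Bool) (g : Gen n) {w w′ : S n} → w ≃ w′ → ·sᵇ b w g ≃ ·sᵇ b w′ g
·sᵇ-cong true  g e = ·-congʳ (s g) e
·sᵇ-cong false g e = e

s·ᵇ-·sᵇ : (l r : Bool) (a b : Gen n) (w : S n) → s·ᵇ l a (·sᵇ r w b) ≃ ·sᵇ r (s·ᵇ l a w) b
s·ᵇ-·sᵇ true  true  a b w = ≃-refl
s·ᵇ-·sᵇ true  false a b w = ≃-refl
s·ᵇ-·sᵇ false true  a b w = ≃-refl
s·ᵇ-·sᵇ false false a b w = ≃-refl

⊳-cong : (g : Gen n) {w w′ : S n} → w ≃ w′ → g ⊳ w ≃ g ⊳ w′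
⊳-cong g {w} {w′} e rewrite does-cong (ascentˡ? g w) (ascentˡ? g w′) (Ascentˡ-cong g e) (Ascentˡ-cong g (≃-sym e)) =
  s·ᵇ-cong (does (ascentˡ? g w′)) g e

⊲-cong : (g : Gen n) {w w′ : S n} → w ≃ w′ → w ⊲ g ≃ w′ ⊲ g
⊲-cong g {w} {w′} e rewrite does-cong (ascentʳ? g w) (ascentʳ? g w′) (Ascentʳ-cong g e) (Ascentʳ-cong g (≃-sym e)) =
  ·sᵇ-cong (does (ascentʳ? g w′)) g e

ascentˡ⇒ℓ< : (g : Gen n) (w : S n) → Ascentˡ g w → ℓ w ℕ.< ℓ (s g · w)
ascentˡ⇒ℓ< g w asc = ℕP.≤-reflexive (sym (ℓ-s·-ascent g w asc))

ℓ<⇒ascentˡ : (g : Gen n) (w : S n) → ℓ w ℕ.< ℓ (s g · w) → Ascentˡ g w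
ℓ<⇒ascentˡ g w ℓ< with ascentˡ? g w
... | yes asc = asc
... | no ¬asc = ⊥-elim (ℕP.<-asym ℓ< (ℕP.≤-reflexive (ℓ-s·-descent g w ¬asc)))

DemGen⇒≃ : {a : Gen n} {w z : S n} → DemGen a w z → z ≃ a ⊳ w
DemGen⇒≃ {a = a} {w} (up ℓ< e)    = ≃-sym (≃-trans (⊳-ascent a w (ℓ<⇒ascentˡ a w ℓ<)) (mk≃ e))
DemGen⇒≃ {a = a} {w} (down ¬ℓ< e) = ≃-sym (≃-trans (⊳-descent a w (¬ℓ< ∘ ascentˡ⇒ℓ< a w)) (mk≃ e))

≃⇒DemGen : {a : Gen n} {w z : S n} → z ≃ a ⊳ w → DemGen a w z
≃⇒DemGen {a = a} {w} e with ascentˡ? a w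
... | yes asc = up (ascentˡ⇒ℓ< a w asc) (app (≃-sym (≃-trans e (⊳-ascent a w asc))))
... | no ¬asc = down (¬asc ∘ ℓ<⇒ascentˡ a w) (app (≃-sym (≃-trans e (⊳-descent a w ¬asc))))

infixr 6 _⊳*_
_⊳*_ : List (Gen n) → S n → S n
as ⊳* w = L.foldr _⊳_ w as

⊳*-cong : (as : List (Gen n)) {w w′ : S n} → w ≃ w′ → as ⊳* w ≃ as ⊳* w′
⊳*-cong []       e = e
⊳*-cong (a ∷ as) e = ⊳-cong a (⊳*-cong as e)

DemWord⇒≃ : {as : List (Gen n)} {w z : S n} → DemWord as w z → z ≃ as ⊳* w
DemWord⇒≃ (nil e)             = ≃-sym (mk≃ e)
DemWord⇒≃ (cons {a = a} d e) = ≃-trans (DemGen⇒≃ e) (⊳-cong a (DemWord⇒≃ d))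

≃⇒DemWord : (as : List (Gen n)) {w z : S n} → z ≃ as ⊳* w → DemWord as w z
≃⇒DemWord []       e = nil (app (≃-sym e))
≃⇒DemWord (a ∷ as) e = cons (≃⇒DemWord as ≃-refl) (≃⇒DemGen e)

Ends : Gen n → Fin n → Fin n → Set
Ends g i j = (i ≡ lo g × j ≡ hi g) ⊎ (i ≡ hi g × j ≡ lo g)

Ends-sym : (g : Gen n) {i j : Fin n} → Ends g i j → Ends g j i
Ends-sym g (inj₁ (i≡ , j≡)) = inj₂ (j≡ , i≡)
Ends-sym g (inj₂ (i≡ , j≡)) = inj₁ (j≡ , i≡)

σ-Ends : (g : Gen n) {i j : Fin n} → Ends g i j → σ g i ≡ j
σ-Ends g (inj₁ (refl , refl)) = σ-lo g
σ-Ends g (inj₂ (refl , refl)) = σ-hi g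

Ends-≢ : (g : Gen n) {i j k : Fin n} → Ends g i j → k ≢ i → k ≢ j → k ≢ lo g × k ≢ hi g
Ends-≢ g (inj₁ (refl , refl)) k≢i k≢j = k≢i , k≢j
Ends-≢ g (inj₂ (refl , refl)) k≢i k≢j = k≢j , k≢i

·s≃s· : (a b : Gen n) (w : S n) → Ends a (w ⟨$⟩ʳ lo b) (w ⟨$⟩ʳ hi b) → w · s b ≃ s a · w
·s≃s· a b w ends = mk≃ pointwise
  where
    pointwise : ∀ k → w ⟨$⟩ʳ σ b k ≡ σ a (w ⟨$⟩ʳ k)
    pointwise k with position b k
    ... | at-lo refl = trans (cong (w ⟨$⟩ʳ_) (σ-lo b)) (sym (σ-Ends a ends))
    ... | at-hi refl = trans (cong (w ⟨$⟩ʳ_) (σ-hi b)) (sym (σ-Ends a (Ends-sym a ends)))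
    ... | elsewhere k≢lo k≢hi =
      let (≢lo , ≢hi) = Ends-≢ a ends (k≢lo ∘ ⟨$⟩ʳ-injective w) (k≢hi ∘ ⟨$⟩ʳ-injective w)
      in trans (cong (w ⟨$⟩ʳ_) (σ-elsewhere b k≢lo k≢hi)) (sym (σ-elsewhere a ≢lo ≢hi))

ascentʳ-s· : (a b : Gen n) (w : S n) → ¬ Ends a (w ⟨$⟩ʳ lo b) (w ⟨$⟩ʳ hi b) →
  does (ascentʳ? b (s a · w)) ≡ does (ascentʳ? b w)
ascentʳ-s· a b w ¬ends = does-cong (ascentʳ? b (s a · w)) (ascentʳ? b w)
  (λ asc → σ-mono⁻ a asc (¬ends ∘ inj₂)) (λ asc → σ-mono a asc (¬ends ∘ inj₁))

ascentʳ-s·ᵇ : (l : Bool) (a b : Gen n) (w : S n) → ¬ Ends a (w ⟨$⟩ʳ lo b) (w ⟨$⟩ʳ hi b) →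
  does (ascentʳ? b (s·ᵇ l a w)) ≡ does (ascentʳ? b w)
ascentʳ-s·ᵇ true  a b w ¬ends = ascentʳ-s· a b w ¬ends
ascentʳ-s·ᵇ false a b w ¬ends = refl

Ends-⁻¹ : (a b : Gen n) (w : S n) → Ends b (w ⟨$⟩ˡ lo a) (w ⟨$⟩ˡ hi a) → Ends a (w ⟨$⟩ʳ lo b) (w ⟨$⟩ʳ hi b)
Ends-⁻¹ a b w (inj₁ (e₁ , e₂)) = inj₁ (⟨$⟩ˡ⇒⟨$⟩ʳ w e₁ , ⟨$⟩ˡ⇒⟨$⟩ʳ w e₂)
Ends-⁻¹ a b w (inj₂ (e₁ , e₂)) = inj₂ (⟨$⟩ˡ⇒⟨$⟩ʳ w e₂ , ⟨$⟩ˡ⇒⟨$⟩ʳ w e₁)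

ascentˡ-·sᵇ : (r : Bool) (a b : Gen n) (w : S n) → ¬ Ends a (w ⟨$⟩ʳ lo b) (w ⟨$⟩ʳ hi b) →
  does (ascentˡ? a (·sᵇ r w b)) ≡ does (ascentˡ? a w)
ascentˡ-·sᵇ true a b w ¬ends = begin
  does (ascentʳ? a ((w · s b) ⁻¹))
    ≡⟨ does-cong (ascentʳ? a ((w · s b) ⁻¹)) (ascentʳ? a (s b · w ⁻¹))
         (Ascentʳ-cong a (⁻¹-·s b w)) (Ascentʳ-cong a (≃-sym (⁻¹-·s b w))) ⟩
  does (ascentʳ? a (s b · w ⁻¹))
    ≡⟨ ascentʳ-s· b a (w ⁻¹) (¬ends ∘ Ends-⁻¹ a b w) ⟩
  does (ascentʳ? a (w ⁻¹)) ∎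
  where open ≡-Reasoning
ascentˡ-·sᵇ false a b w ¬ends = refl

-- Unless w carries the ends of b onto those of a, the two ascent tests do not interact.
⊳-⊲-assoc : (a b : Gen n) (w : S n) → a ⊳ (w ⊲ b) ≃ (a ⊳ w) ⊲ b
⊳-⊲-assoc a b w with (w ⟨$⟩ʳ lo b FP.≟ lo a) ×-dec (w ⟨$⟩ʳ hi b FP.≟ hi a)
                   | (w ⟨$⟩ʳ lo b FP.≟ hi a) ×-dec (w ⟨$⟩ʳ hi b FP.≟ lo a)
... | yes (e₁ , e₂) | _ = begin
  a ⊳ (w ⊲ b)     ≈⟨ ⊳-cong a (⊲-ascent b w ascʳ) ⟩
  a ⊳ (w · s b)   ≈⟨ ⊳-descent a (w · s b) ¬ascˡ ⟩
  w · s b         ≈⟨ ·s≃s· a b w (inj₁ (e₁ , e₂)) ⟩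
  s a · w         ≈⟨ ⊲-descent b (s a · w) ¬ascʳ ⟨
  (s a · w) ⊲ b   ≈⟨ ⊲-cong b (⊳-ascent a w ascˡ) ⟨
  (a ⊳ w) ⊲ b     ∎
  where
    open ≃-Reasoning
    w⁻¹lo = ⟨$⟩ʳ⇒⟨$⟩ˡ w e₁
    w⁻¹hi = ⟨$⟩ʳ⇒⟨$⟩ˡ w e₂
    ascʳ : Ascentʳ b w
    ascʳ = subst₂ F._<_ (sym e₁) (sym e₂) (lo<hi a)
    ascˡ : Ascentˡ a w
    ascˡ = subst₂ F._<_ (sym w⁻¹lo) (sym w⁻¹hi) (lo<hi b)
    ¬ascˡ : ¬ Ascentˡ a (w · s b)
    ¬ascˡ asc = ℕP.<-asym (lo<hi b)
      (subst₂ F._<_ (trans (s⁻¹-apply b (w ⟨$⟩ˡ lo a)) (trans (cong (σ b) w⁻¹lo) (σ-lo b)))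
                    (trans (s⁻¹-apply b (w ⟨$⟩ˡ hi a)) (trans (cong (σ b) w⁻¹hi) (σ-hi b))) asc)
    ¬ascʳ : ¬ Ascentʳ b (s a · w)
    ¬ascʳ asc = ℕP.<-asym (lo<hi a)
      (subst₂ F._<_ (trans (cong (σ a) e₁) (σ-lo a)) (trans (cong (σ a) e₂) (σ-hi a)) asc)
... | no _ | yes (e₁ , e₂) = begin
  a ⊳ (w ⊲ b)   ≈⟨ ⊳-cong a (⊲-descent b w ¬ascʳ) ⟩
  a ⊳ w         ≈⟨ ⊳-descent a w ¬ascˡ ⟩
  w             ≈⟨ ⊲-descent b w ¬ascʳ ⟨
  w ⊲ b         ≈⟨ ⊲-cong b (⊳-descent a w ¬ascˡ) ⟨
  (a ⊳ w) ⊲ b   ∎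
  where
    open ≃-Reasoning
    ¬ascʳ : ¬ Ascentʳ b w
    ¬ascʳ asc = ℕP.<-asym (lo<hi a) (subst₂ F._<_ e₁ e₂ asc)
    ¬ascˡ : ¬ Ascentˡ a w
    ¬ascˡ asc = ℕP.<-asym (lo<hi b) (subst₂ F._<_ (⟨$⟩ʳ⇒⟨$⟩ˡ w e₂) (⟨$⟩ʳ⇒⟨$⟩ˡ w e₁) asc)
... | no ¬same | no ¬opposite = begin
  a ⊳ (w ⊲ b)
    ≡⟨ cong (λ l → s·ᵇ l a (w ⊲ b)) (ascentˡ-·sᵇ R a b w ¬ends) ⟩
  s·ᵇ L a (·sᵇ R w b)
    ≈⟨ s·ᵇ-·sᵇ L R a b w ⟩
  ·sᵇ R (s·ᵇ L a w) b
    ≡⟨ cong (λ r → ·sᵇ r (a ⊳ w) b) (ascentʳ-s·ᵇ L a b w ¬ends) ⟨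
  (a ⊳ w) ⊲ b ∎
  where
    open ≃-Reasoning
    L = does (ascentˡ? a w)
    R = does (ascentʳ? b w)
    ¬ends : ¬ Ends a (w ⟨$⟩ʳ lo b) (w ⟨$⟩ʳ hi b)
    ¬ends = [ ¬same , ¬opposite ]

⊳*-⊲ : (as : List (Gen n)) (b : Gen n) (w : S n) → as ⊳* (w ⊲ b) ≃ (as ⊳* w) ⊲ b
⊳*-⊲ []       b w = ≃-refl
⊳*-⊲ (a ∷ as) b w = ≃-trans (⊳-cong a (⊳*-⊲ as b w)) (⊳-⊲-assoc a b (as ⊳* w))

record Invol (y : S n) : Set where
  constructor mkInvol
  field involutive : IsInvolution y
open Invol public

Invol-cong : {x y : S n} → x ≃ y → Invol x → Invol y
Invol-cong {x = x} (mk≃ e) (mkInvol inv) = mkInvol λ i → trans (sym (e _)) (trans (cong (x ⟨$⟩ʳ_) (sym (e i))) (inv i))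

Invol-id : Invol (P.id {n})
Invol-id = mkInvol λ _ → refl

Invol-⟨$⟩ˡ : {y : S n} → Invol y → ∀ i → y ⟨$⟩ˡ i ≡ y ⟨$⟩ʳ i
Invol-⟨$⟩ˡ {y = y} inv i = ⟨$⟩ʳ⇒⟨$⟩ˡ y (involutive inv i)

Invol-ascentˡ⇒ʳ : (g : Gen n) {y : S n} → Invol y → Ascentˡ g y → Ascentʳ g y
Invol-ascentˡ⇒ʳ g inv = subst₂ F._<_ (Invol-⟨$⟩ˡ inv (lo g)) (Invol-⟨$⟩ˡ inv (hi g))

Stable : Gen n → S n → Set
Stable g y = Ends g (y ⟨$⟩ʳ lo g) (y ⟨$⟩ʳ hi g)

stable? : (g : Gen n) (y : S n) → Dec (Stable g y)
stable? g y = ((y ⟨$⟩ʳ lo g FP.≟ lo g) ×-dec (y ⟨$⟩ʳ hi g FP.≟ hi g))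
         ⊎-dec ((y ⟨$⟩ʳ lo g FP.≟ hi g) ×-dec (y ⟨$⟩ʳ hi g FP.≟ lo g))

Stable-cong : (g : Gen n) {y y′ : S n} → y ≃ y′ → Stable g y → Stable g y′
Stable-cong g (mk≃ e) (inj₁ (e₁ , e₂)) = inj₁ (trans (sym (e _)) e₁ , trans (sym (e _)) e₂)
Stable-cong g (mk≃ e) (inj₂ (e₁ , e₂)) = inj₂ (trans (sym (e _)) e₁ , trans (sym (e _)) e₂)

twistᵇ : Bool → Gen n → S n → S n
twistᵇ true  g y = y · s g
twistᵇ false g y = s g · y · s g

-- Twisted conjugation: s ⋉ y = y s if s and y commute (that is, Stable), and s y s otherwise.
infixr 6 _⋉_
_⋉_ : Gen n → S n → S n
g ⋉ y = twistᵇ (does (stable? g y)) g y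

⋉-stable : (g : Gen n) (y : S n) → Stable g y → g ⋉ y ≃ y · s g
⋉-stable g y st rewrite dec-true (stable? g y) st = ≃-refl

⋉-unstable : (g : Gen n) (y : S n) → ¬ Stable g y → g ⋉ y ≃ s g · y · s g
⋉-unstable g y ¬st rewrite dec-false (stable? g y) ¬st = ≃-refl

⋉-cong : (g : Gen n) {y y′ : S n} → y ≃ y′ → g ⋉ y ≃ g ⋉ y′
⋉-cong g {y} {y′} e with stable? g y
... | yes st = ≃-trans (⋉-stable g y st)
  (≃-trans (·-congʳ (s g) e) (≃-sym (⋉-stable g y′ (Stable-cong g e st))))
... | no ¬st = ≃-trans (⋉-unstable g y ¬st)
  (≃-trans (·-congʳ (s g) (·-congˡ (s g) e)) (≃-sym (⋉-unstable g y′ (¬st ∘ Stable-cong g (≃-sym e)))))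

Stable-·s : (g : Gen n) (y : S n) → Stable g y → Stable g (y · s g)
Stable-·s g y st = subst₂ (Ends g) (cong (y ⟨$⟩ʳ_) (sym (σ-lo g))) (cong (y ⟨$⟩ʳ_) (sym (σ-hi g))) (Ends-sym g st)

σ-Ends⁻ : (g : Gen n) {i j : Fin n} → Ends g (σ g i) (σ g j) → Ends g i j
σ-Ends⁻ g {i} {j} (inj₁ (e₁ , e₂)) =
  inj₂ ( trans (sym (σ-involutive g i)) (trans (cong (σ g) e₁) (σ-lo g))
       , trans (sym (σ-involutive g j)) (trans (cong (σ g) e₂) (σ-hi g)))
σ-Ends⁻ g {i} {j} (inj₂ (e₁ , e₂)) =
  inj₁ ( trans (sym (σ-involutive g i)) (trans (cong (σ g) e₁) (σ-hi g))
       , trans (sym (σ-involutive g j)) (trans (cong (σ g) e₂) (σ-lo g)))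

¬Stable-s·s : (g : Gen n) (y : S n) → ¬ Stable g y → ¬ Stable g (s g · y · s g)
¬Stable-s·s g y ¬st st = ¬st (Ends-sym g (σ-Ends⁻ g
  (subst₂ (λ i j → Ends g (σ g (y ⟨$⟩ʳ i)) (σ g (y ⟨$⟩ʳ j))) (σ-lo g) (σ-hi g) st)))

⋉-involutive : (g : Gen n) (y : S n) → g ⋉ g ⋉ y ≃ y
⋉-involutive g y with stable? g y
... | yes st = begin
  g ⋉ g ⋉ y           ≈⟨ ⋉-cong g (⋉-stable g y st) ⟩
  g ⋉ (y · s g)       ≈⟨ ⋉-stable g (y · s g) (Stable-·s g y st) ⟩
  y · s g · s g       ≈⟨ ·s·s g y ⟩
  y                   ∎
  where open ≃-Reasoning
... | no ¬st = begin
  g ⋉ g ⋉ y                     ≈⟨ ⋉-cong g (⋉-unstable g y ¬st) ⟩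
  g ⋉ (s g · y · s g)           ≈⟨ ⋉-unstable g (s g · y · s g) (¬Stable-s·s g y ¬st) ⟩
  s g · (s g · y · s g) · s g   ≈⟨ mk≃ (λ i → trans (σ-involutive g _) (cong (y ⟨$⟩ʳ_) (σ-involutive g i))) ⟩
  y                             ∎
  where open ≃-Reasoning

Invol-⋉ : (g : Gen n) {y : S n} → Invol y → Invol (g ⋉ y)
Invol-⋉ g {y} inv with stable? g y
... | yes st = Invol-cong (≃-sym (⋉-stable g y st)) (mkInvol λ i → begin
  y ⟨$⟩ʳ σ g (y ⟨$⟩ʳ σ g i)   ≡⟨ app (·s≃s· g g y st) (y ⟨$⟩ʳ σ g i) ⟩
  σ g (y ⟨$⟩ʳ (y ⟨$⟩ʳ σ g i)) ≡⟨ cong (σ g) (involutive inv (σ g i)) ⟩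
  σ g (σ g i)                 ≡⟨ σ-involutive g i ⟩
  i                           ∎)
  where open ≡-Reasoning
... | no ¬st = Invol-cong (≃-sym (⋉-unstable g y ¬st)) (mkInvol λ i →
  trans (cong (σ g ∘ (y ⟨$⟩ʳ_)) (σ-involutive g _)) (trans (cong (σ g) (involutive inv _)) (σ-involutive g i)))

Ends-image⇒Stable : (g : Gen n) (y : S n) {i j : Fin n} → Ends g i j → Ends g (y ⟨$⟩ʳ i) (y ⟨$⟩ʳ j) → Stable g y
Ends-image⇒Stable g y (inj₁ (refl , refl)) ends = ends
Ends-image⇒Stable g y (inj₂ (refl , refl)) ends = Ends-sym g ends

⋉-flips : (g : Gen n) (y : S n) {i j : Fin n} → Ends g i j →
  y ⟨$⟩ʳ i F.< y ⟨$⟩ʳ j → (g ⋉ y) ⟨$⟩ʳ j F.< (g ⋉ y) ⟨$⟩ʳ i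
⋉-flips g y {i} {j} ij yi<yj with stable? g y
... | yes st = subst₂ F._<_ (sym (app (⋉-stable g y st) j)) (sym (app (⋉-stable g y st) i))
      (subst₂ F._<_ (cong (y ⟨$⟩ʳ_) (sym (σ-Ends g (Ends-sym g ij)))) (cong (y ⟨$⟩ʳ_) (sym (σ-Ends g ij))) yi<yj)
... | no ¬st = subst₂ F._<_ (sym (app (⋉-unstable g y ¬st) j)) (sym (app (⋉-unstable g y ¬st) i))
      (subst₂ F._<_ (cong (σ g ∘ (y ⟨$⟩ʳ_)) (sym (σ-Ends g (Ends-sym g ij))))
                    (cong (σ g ∘ (y ⟨$⟩ʳ_)) (sym (σ-Ends g ij)))
        (σ-mono g yi<yj (¬st ∘ Ends-image⇒Stable g y ij ∘ inj₁)))

⋉-ascent : (g : Gen n) (y : S n) → ¬ Ascentʳ g y → Ascentʳ g (g ⋉ y)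
⋉-ascent g y ¬asc = ⋉-flips g y (inj₂ (refl , refl)) (¬ascent⇒descent g y ¬asc)

⋉-descent : (g : Gen n) (y : S n) → Ascentʳ g y → ¬ Ascentʳ g (g ⋉ y)
⋉-descent g y asc = ℕP.<-asym (⋉-flips g y (inj₁ (refl , refl)) asc)

Invol-swap : {y : S n} → Invol y → {i j : Fin n} → y ⟨$⟩ʳ i ≡ j → y ⟨$⟩ʳ j ≡ i
Invol-swap {y = y} inv {i} refl = involutive inv i

Stable-ascent⇒fixes : (g : Gen n) (y : S n) → Ascentʳ g y → Stable g y →
  y ⟨$⟩ʳ lo g ≡ lo g × y ⟨$⟩ʳ hi g ≡ hi g
Stable-ascent⇒fixes g y asc (inj₁ fixes) = fixes
Stable-ascent⇒fixes g y asc (inj₂ (e₁ , e₂)) = ⊥-elim (ℕP.<-asym asc (subst₂ F._<_ (sym e₂) (sym e₁) (lo<hi g)))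

ascentˡ-·s : (g : Gen n) {y : S n} → Invol y → Ascentʳ g y → ¬ Stable g y → Ascentˡ g (y · s g)
ascentˡ-·s g {y} inv asc ¬st = Ascentʳ-cong g (≃-sym (⁻¹-·s g y))
  (subst₂ F._<_ (cong (σ g) (sym (Invol-⟨$⟩ˡ inv (lo g)))) (cong (σ g) (sym (Invol-⟨$⟩ˡ inv (hi g))))
    (σ-mono g asc (¬st ∘ inj₁)))

¬ascentˡ-·s : (g : Gen n) {y : S n} → Invol y → Ascentʳ g y → Stable g y → ¬ Ascentˡ g (y · s g)
¬ascentˡ-·s g {y} inv asc st ascˡ = ⋉-descent g y asc
  (Ascentʳ-cong g (≃-sym (⋉-stable g y st))
    (Invol-ascentˡ⇒ʳ g (Invol-cong (⋉-stable g y st) (Invol-⋉ g inv)) ascˡ))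

⊳⊲-ascent : (g : Gen n) {y : S n} → Invol y → Ascentʳ g y → g ⊳ y ⊲ g ≃ g ⋉ y
⊳⊲-ascent g {y} inv asc with stable? g y
... | yes st = begin
  g ⊳ y ⊲ g       ≈⟨ ⊳-cong g (⊲-ascent g y asc) ⟩
  g ⊳ (y · s g)   ≈⟨ ⊳-descent g (y · s g) (¬ascentˡ-·s g inv asc st) ⟩
  y · s g         ≈⟨ ⋉-stable g y st ⟨
  g ⋉ y           ∎
  where open ≃-Reasoning
... | no ¬st = begin
  g ⊳ y ⊲ g       ≈⟨ ⊳-cong g (⊲-ascent g y asc) ⟩
  g ⊳ (y · s g)   ≈⟨ ⊳-ascent g (y · s g) (ascentˡ-·s g inv asc ¬st) ⟩
  s g · y · s g   ≈⟨ ⋉-unstable g y ¬st ⟨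
  g ⋉ y           ∎
  where open ≃-Reasoning

⊳⊲-descent : (g : Gen n) {y : S n} → Invol y → ¬ Ascentʳ g y → g ⊳ y ⊲ g ≃ y
⊳⊲-descent g {y} inv ¬asc =
  ≃-trans (⊳-cong g (⊲-descent g y ¬asc)) (⊳-descent g y (¬asc ∘ Invol-ascentˡ⇒ʳ g inv))

Invol-⊳⊲ : (g : Gen n) {y : S n} → Invol y → Invol (g ⊳ y ⊲ g)
Invol-⊳⊲ g {y} inv with ascentʳ? g y
... | yes asc = Invol-cong (≃-sym (⊳⊲-ascent g inv asc)) (Invol-⋉ g inv)
... | no ¬asc = Invol-cong (≃-sym (⊳⊲-descent g inv ¬asc)) inv

⊳⊲-⋉ : (g : Gen n) {x : S n} → Invol x → ¬ Ascentʳ g x → g ⊳ (g ⋉ x) ⊲ g ≃ x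
⊳⊲-⋉ g {x} inv ¬asc = ≃-trans (⊳⊲-ascent g (Invol-⋉ g inv) (⋉-ascent g x ¬asc)) (⋉-involutive g x)

excedances : S n → ℕ
excedances y = sum λ i → 𝟙 (i FP.<? y ⟨$⟩ʳ i)

excedances-cong : {x y : S n} → x ≃ y → excedances x ≡ excedances y
excedances-cong (mk≃ e) = sum-cong-≗ λ i → 𝟙-cong (subst (i F.<_) (e i)) (subst (i F.<_) (sym (e i))) _ _

excedances-id : excedances (P.id {n}) ≡ 0
excedances-id {n} = trans (sum-cong-≗ {n} λ i → 𝟙-no (ℕP.<-irrefl refl) (i FP.<? i)) (sum-replicate-zero n)

excedances-·s : (g : Gen n) (y : S n) → y ⟨$⟩ʳ lo g ≡ lo g → y ⟨$⟩ʳ hi g ≡ hi g →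
  excedances (y · s g) ≡ suc (excedances y)
excedances-·s {n} g y fix-lo fix-hi = begin
  sum (λ i → 𝟙 (i FP.<? y ⟨$⟩ʳ σ g i))
    ≡⟨ sum-cong-≗ pointwise ⟩
  sum (λ i → 𝟙 (i FP.<? y ⟨$⟩ʳ i) + δ (lo g) i * 1)
    ≡⟨ ∑-distrib-+ (λ i → 𝟙 (i FP.<? y ⟨$⟩ʳ i)) (λ i → δ (lo g) i * 1) ⟩
  excedances y + sum (λ i → δ (lo g) i * 1)
    ≡⟨ cong (excedances y +_) (∑-δ (lo g) (λ _ → 1)) ⟩
  excedances y + 1
    ≡⟨ ℕP.+-comm (excedances y) 1 ⟩
  suc (excedances y) ∎
  where
    open ≡-Reasoning
    pointwise : ∀ i → 𝟙 (i FP.<? y ⟨$⟩ʳ σ g i) ≡ 𝟙 (i FP.<? y ⟨$⟩ʳ i) + δ (lo g) i * 1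
    pointwise i with position g i
    ... | at-lo refl rewrite σ-lo g | fix-lo | fix-hi
      | 𝟙-yes (lo<hi g) (lo g FP.<? hi g) | 𝟙-no (ℕP.<-irrefl refl) (lo g FP.<? lo g)
      | 𝟙-yes refl (lo g FP.≟ lo g) = refl
    ... | at-hi refl rewrite σ-hi g | fix-lo | fix-hi
      | 𝟙-no (ℕP.<-asym (lo<hi g)) (hi g FP.<? lo g) | 𝟙-no (ℕP.<-irrefl refl) (hi g FP.<? hi g)
      | 𝟙-no (lo≢hi g ∘ sym) (hi g FP.≟ lo g) = refl
    ... | elsewhere i≢lo i≢hi rewrite σ-elsewhere g i≢lo i≢hi | 𝟙-no i≢lo (i FP.≟ lo g) =
      sym (ℕP.+-identityʳ _)

excedances-s·s : (g : Gen n) {y : S n} → Invol y → ¬ Stable g y → excedances (s g · y · s g) ≡ excedances y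
excedances-s·s g {y} inv ¬st = trans (∑-permute _ (s g)) (sum-cong-≗ pointwise)
  where
    pointwise : ∀ i → 𝟙 (σ g i FP.<? σ g (y ⟨$⟩ʳ σ g (σ g i))) ≡ 𝟙 (i FP.<? y ⟨$⟩ʳ i)
    pointwise i rewrite σ-involutive g i = 𝟙-cong
      (λ lt → σ-mono⁻ g lt λ (i≡hi , e) → swapped (trans (cong (y ⟨$⟩ʳ_) (sym i≡hi)) e))
      (λ lt → σ-mono g lt λ (i≡lo , e) → swapped (Invol-swap inv (trans (cong (y ⟨$⟩ʳ_) (sym i≡lo)) e)))
      _ _
      where
        swapped : y ⟨$⟩ʳ hi g ≡ lo g → ⊥
        swapped e = ¬st (inj₂ (Invol-swap inv e , e))

-- Twice the involution length: for an involution y, (ℓ y + excedances y) / 2, where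
-- excedances y counts the 2-cycles of y.
twiceInvLength : S n → ℕ
twiceInvLength y = ℓ y + excedances y

twiceInvLength-cong : {x y : S n} → x ≃ y → twiceInvLength x ≡ twiceInvLength y
twiceInvLength-cong e = cong₂ _+_ (ℓ-cong e) (excedances-cong e)

twiceInvLength-id : twiceInvLength (P.id {n}) ≡ 0
twiceInvLength-id {n} = cong₂ _+_ (ℓ-id {n}) (excedances-id {n})

twiceInvLength-⋉ : (g : Gen n) {y : S n} → Invol y → Ascentʳ g y → twiceInvLength (g ⋉ y) ≡ 2 + twiceInvLength y
twiceInvLength-⋉ g {y} inv asc with stable? g y
... | yes st = begin
  twiceInvLength (g ⋉ y)                     ≡⟨ twiceInvLength-cong (⋉-stable g y st) ⟩
  ℓ (y · s g) + excedances (y · s g)         ≡⟨ cong₂ _+_ (ℓ-·s-ascent g y asc) (excedances-·s g y fix-lo fix-hi) ⟩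
  suc (ℓ y) + suc (excedances y)             ≡⟨ cong suc (ℕP.+-suc (ℓ y) (excedances y)) ⟩
  2 + twiceInvLength y                       ∎
  where
    open ≡-Reasoning
    fix-lo = proj₁ (Stable-ascent⇒fixes g y asc st)
    fix-hi = proj₂ (Stable-ascent⇒fixes g y asc st)
... | no ¬st = begin
  twiceInvLength (g ⋉ y)                           ≡⟨ twiceInvLength-cong (⋉-unstable g y ¬st) ⟩
  ℓ (s g · (y · s g)) + excedances (s g · y · s g) ≡⟨ cong₂ _+_ ℓ-s·s (excedances-s·s g inv ¬st) ⟩
  2 + twiceInvLength y                             ∎
  where
    open ≡-Reasoning
    ℓ-s·s : ℓ (s g · (y · s g)) ≡ 2 + ℓ y
    ℓ-s·s = trans (ℓ-s·-ascent g (y · s g) (ascentˡ-·s g inv asc ¬st)) (cong suc (ℓ-·s-ascent g y asc))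

twiceInvLength-descent : (g : Gen n) {x : S n} → Invol x → ¬ Ascentʳ g x →
  twiceInvLength x ≡ 2 + twiceInvLength (g ⋉ x)
twiceInvLength-descent g {x} inv ¬asc =
  trans (twiceInvLength-cong (≃-sym (⋉-involutive g x))) (twiceInvLength-⋉ g (Invol-⋉ g inv) (⋉-ascent g x ¬asc))

twiceInvLength-⊳⊲-≤ : (g : Gen n) {y : S n} → Invol y → twiceInvLength (g ⊳ y ⊲ g) ℕ.≤ 2 + twiceInvLength y
twiceInvLength-⊳⊲-≤ g {y} inv with ascentʳ? g y
... | yes asc = ℕP.≤-reflexive (trans (twiceInvLength-cong (⊳⊲-ascent g inv asc)) (twiceInvLength-⋉ g inv asc))
... | no ¬asc = ℕP.≤-trans (ℕP.≤-reflexive (twiceInvLength-cong (⊳⊲-descent g inv ¬asc)))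
                           (ℕP.≤-trans (ℕP.n≤1+n _) (ℕP.n≤1+n _))

DemazureSquare : S n → S n → Set
DemazureSquare v x = Demazure (v ⁻¹) v x

ℓ-prod : (as : List (Gen n)) → ℓ (prod as) ℕ.≤ length as
ℓ-prod {n} []       = ℕP.≤-reflexive (ℓ-id {n})
ℓ-prod (a ∷ as) = ℕP.≤-trans (ℓ-s·-≤ a (prod as)) (s≤s (ℓ-prod as))

record ReducedCons (a : Gen n) (as : List (Gen n)) (v : S n) : Set where
  field
    reduced : IsReducedWord as ((v · s a) ⁻¹)
    ℓ-suc   : ℓ v ≡ suc (ℓ (v · s a))
    fold    : (a ∷ as) ⊳* v ≃ a ⊳ (as ⊳* (v · s a)) ⊲ a

reducedCons : (a : Gen n) (as : List (Gen n)) (v : S n) → IsReducedWord (a ∷ as) (v ⁻¹) → ReducedCons a as v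
reducedCons a as v (prod≈ , len≡) = record { reduced = app prod-as≈ , length-as ; ℓ-suc = ℓv ; fold = fold }
  where
    prod≃ : prod (a ∷ as) ≃ v ⁻¹
    prod≃ = mk≃ prod≈
    prod-as≈ : prod as ≃ (v · s a) ⁻¹
    prod-as≈ = begin
      prod as                  ≈⟨ s·s· a (prod as) ⟨
      s a · prod (a ∷ as)      ≈⟨ ·-congˡ (s a) prod≃ ⟩
      s a · v ⁻¹               ≈⟨ ⁻¹-·s a v ⟨
      (v · s a) ⁻¹             ∎
      where open ≃-Reasoning
    length-as : length as ≡ ℓ ((v · s a) ⁻¹)
    length-as = trans (ℕP.≤-antisym length≤ℓ (ℓ-prod as)) (ℓ-cong prod-as≈)
      where
        length≤ℓ : length as ℕ.≤ ℓ (prod as)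
        length≤ℓ = ℕP.≤-pred (subst (ℕ._≤ suc (ℓ (prod as))) (trans (ℓ-cong prod≃) (sym len≡))
                                   (ℓ-s·-≤ a (prod as)))
    ℓv : ℓ v ≡ suc (ℓ (v · s a))
    ℓv = trans (sym (ℓ-⁻¹ v)) (trans (sym len≡) (cong suc (trans length-as (ℓ-⁻¹ (v · s a)))))
    ascent : Ascentʳ a (v · s a)
    ascent = decidable-stable (ascentʳ? a (v · s a)) λ ¬asc → ℕP.m≢1+n+m (ℓ (v · s a))
      (trans (sym (ℓ-·s-descent a (v · s a) ¬asc)) (cong suc (trans (ℓ-cong (·s·s a v)) ℓv)))
    fold : (a ∷ as) ⊳* v ≃ a ⊳ (as ⊳* (v · s a)) ⊲ a
    fold = ⊳-cong a (≃-trans (⊳*-cong as (≃-sym (≃-trans (⊲-ascent a (v · s a) ascent) (·s·s a v))))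
                             (⊳*-⊲ as a (v · s a)))

reducedWord-bound : (as : List (Gen n)) (v x : S n) → IsReducedWord as (v ⁻¹) → x ≃ as ⊳* v →
  Invol x × twiceInvLength x ℕ.≤ ℓ v + ℓ v
reducedWord-bound {n} []       v x (prod≈ , _) x≃ =
  Invol-cong (≃-sym x≃id) Invol-id ,
  ℕP.≤-trans (ℕP.≤-reflexive (trans (twiceInvLength-cong x≃id) (twiceInvLength-id {n}))) z≤n
  where
    x≃id : x ≃ P.id
    x≃id = ≃-trans x≃ (⁻¹≃id (≃-sym (mk≃ prod≈)))
reducedWord-bound (a ∷ as) v x red x≃ = Invol-cong (≃-sym x≃′) (Invol-⊳⊲ a (proj₁ IH)) , bound
  where
    open ReducedCons (reducedCons a as v red)
    y = as ⊳* (v · s a)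
    IH = reducedWord-bound as (v · s a) y reduced ≃-refl
    x≃′ : x ≃ a ⊳ y ⊲ a
    x≃′ = ≃-trans x≃ fold
    bound : twiceInvLength x ℕ.≤ ℓ v + ℓ v
    bound = begin
      twiceInvLength x                    ≡⟨ twiceInvLength-cong x≃′ ⟩
      twiceInvLength (a ⊳ y ⊲ a)          ≤⟨ twiceInvLength-⊳⊲-≤ a (proj₁ IH) ⟩
      2 + twiceInvLength y                ≤⟨ s≤s (s≤s (proj₂ IH)) ⟩
      2 + (ℓ (v · s a) + ℓ (v · s a))     ≡⟨ cong suc (sym (ℕP.+-suc _ _)) ⟩
      suc (ℓ (v · s a)) + suc (ℓ (v · s a)) ≡⟨ cong₂ _+_ ℓ-suc ℓ-suc ⟨
      ℓ v + ℓ v                           ∎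
      where open ℕP.≤-Reasoning

DemazureSquare-bound : {v x : S n} → DemazureSquare v x → Invol x × twiceInvLength x ℕ.≤ ℓ v + ℓ v
DemazureSquare-bound {v = v} {x} (as , red , dw) = reducedWord-bound as v x red (DemWord⇒≃ dw)

DemazureSquare-cong : {v x x′ : S n} → DemazureSquare v x → x ≃ x′ → DemazureSquare v x′
DemazureSquare-cong (as , red , dw) e = as , red , ≃⇒DemWord as (≃-trans (≃-sym e) (DemWord⇒≃ dw))

⊳-descentʳ : (a b : Gen n) (w : S n) → ¬ Ascentʳ b w → ¬ Ascentʳ b (a ⊳ w)
⊳-descentʳ a b w ¬asc with ascentˡ? a w
... | no ¬ascˡ = ¬asc ∘ Ascentʳ-cong b (⊳-descent a w ¬ascˡ)
... | yes ascˡ = λ asc → ¬asc (σ-mono⁻ a (Ascentʳ-cong b (⊳-ascent a w ascˡ) asc) swapped)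
  where
    swapped : ¬ (w ⟨$⟩ʳ lo b ≡ hi a × w ⟨$⟩ʳ hi b ≡ lo a)
    swapped (e₁ , e₂) = ℕP.<-asym (lo<hi b) (subst₂ F._<_ (⟨$⟩ʳ⇒⟨$⟩ˡ w e₂) (⟨$⟩ʳ⇒⟨$⟩ˡ w e₁) ascˡ)

⊳*-descentʳ : (as : List (Gen n)) (b : Gen n) (w : S n) → ¬ Ascentʳ b w → ¬ Ascentʳ b (as ⊳* w)
⊳*-descentʳ []       b w ¬asc = ¬asc
⊳*-descentʳ (a ∷ as) b w ¬asc = ⊳-descentʳ a b (as ⊳* w) (⊳*-descentʳ as b w ¬asc)

DemazureSquare-descent : (b : Gen n) {v x : S n} → DemazureSquare v x → ¬ Ascentʳ b v → ¬ Ascentʳ b x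
DemazureSquare-descent b {v} (as , _ , dw) ¬asc = ⊳*-descentʳ as b v ¬asc ∘ Ascentʳ-cong b (DemWord⇒≃ dw)

record IsAtom (x v : S n) : Set where
  field
    square  : DemazureSquare v x
    doubleℓ : ℓ v + ℓ v ≡ twiceInvLength x
open IsAtom public

IsAtom-cong : {x x′ v : S n} → x ≃ x′ → IsAtom x v → IsAtom x′ v
IsAtom-cong e at = record
  { square = DemazureSquare-cong (square at) e ; doubleℓ = trans (doubleℓ at) (twiceInvLength-cong e) }

DemazureSquare-ascent : (g : Gen n) {v x : S n} → DemazureSquare v x → Ascentʳ g x → Ascentʳ g v
DemazureSquare-ascent g {v} sq asc = decidable-stable (ascentʳ? g v) λ ¬asc → DemazureSquare-descent g sq ¬asc asc

IsReducedWord-∷ : (g : Gen n) (as : List (Gen n)) (u : S n) → Ascentʳ g u →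
  IsReducedWord as (u ⁻¹) → IsReducedWord (g ∷ as) ((u · s g) ⁻¹)
IsReducedWord-∷ g as u asc (prod≈ , len≡) = app prod≃ , length≡
  where
    prod≃ : prod (g ∷ as) ≃ (u · s g) ⁻¹
    prod≃ = ≃-trans (·-congˡ (s g) (mk≃ {u = prod as} {u ⁻¹} prod≈)) (≃-sym (⁻¹-·s g u))
    length≡ : suc (length as) ≡ ℓ ((u · s g) ⁻¹)
    length≡ = trans (cong suc (trans len≡ (ℓ-⁻¹ u))) (trans (sym (ℓ-·s-ascent g u asc)) (sym (ℓ-⁻¹ (u · s g))))

DemazureSquare-extend : (g : Gen n) {u y : S n} → DemazureSquare u y → Ascentʳ g y →
  DemazureSquare (u · s g) (g ⊳ y ⊲ g)
DemazureSquare-extend g {u} {y} sq@(as , red , dw) ascʸ =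
  g ∷ as , IsReducedWord-∷ g as u ascᵘ red , ≃⇒DemWord (g ∷ as) (begin
    g ⊳ y ⊲ g              ≈⟨ ⊳-cong g (⊲-cong g (DemWord⇒≃ dw)) ⟩
    g ⊳ (as ⊳* u) ⊲ g      ≈⟨ ⊳-cong g (⊳*-⊲ as g u) ⟨
    g ⊳ as ⊳* (u ⊲ g)      ≈⟨ ⊳-cong g (⊳*-cong as (⊲-ascent g u ascᵘ)) ⟩
    g ⊳ as ⊳* (u · s g)    ∎)
  where
    open ≃-Reasoning
    ascᵘ = DemazureSquare-ascent g sq ascʸ

IsAtom-extend : (g : Gen n) {x u : S n} → Invol x → ¬ Ascentʳ g x → IsAtom (g ⋉ x) u → IsAtom x (u · s g)
IsAtom-extend g {x} {u} inv ¬asc at = record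
  { square  = DemazureSquare-cong (DemazureSquare-extend g (square at) ascʸ) (⊳⊲-⋉ g inv ¬asc)
  ; doubleℓ = begin
      ℓ (u · s g) + ℓ (u · s g)    ≡⟨ cong₂ _+_ ℓ-us ℓ-us ⟩
      suc (ℓ u) + suc (ℓ u)        ≡⟨ cong suc (ℕP.+-suc (ℓ u) (ℓ u)) ⟩
      2 + (ℓ u + ℓ u)              ≡⟨ cong (2 +_) (doubleℓ at) ⟩
      2 + twiceInvLength (g ⋉ x)   ≡⟨ twiceInvLength-descent g inv ¬asc ⟨
      twiceInvLength x             ∎ }
  where
    open ≡-Reasoning
    ascʸ = ⋉-ascent g x ¬asc
    ℓ-us : ℓ (u · s g) ≡ suc (ℓ u)
    ℓ-us = ℓ-·s-ascent g u (DemazureSquare-ascent g (square at) ascʸ)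

gen-ending-at : (j : Fin n) {m : ℕ} → toℕ j ≡ suc m → Σ[ g ∈ Gen n ] hi g ≡ j × toℕ (lo g) ≡ m
gen-ending-at {n} j {m} e = (i , p) , FP.toℕ-injective (trans (FP.toℕ-fromℕ< p) (trans (cong suc toℕ-i) (sym e))) , toℕ-i
  where
    m<n : m ℕ.< n
    m<n = ℕP.<-trans (ℕP.n<1+n m) (subst (ℕ._< n) e (FP.toℕ<n j))
    i = fromℕ< m<n
    toℕ-i : toℕ i ≡ m
    toℕ-i = FP.toℕ-fromℕ< m<n
    p : suc (toℕ i) ℕ.< n
    p = subst (λ t → suc t ℕ.< n) (sym toℕ-i) (subst (ℕ._< n) e (FP.toℕ<n j))

≤⇒≡suc : {a b : ℕ} → suc a ℕ.≤ b → Σ[ m ∈ ℕ ] b ≡ suc m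
≤⇒≡suc (s≤s {n = m} _) = m , refl

gen-after : (i j : Fin n) → i F.< j → Gen n
gen-after i j i<j = i , ℕP.≤-<-trans i<j (FP.toℕ<n j)

gen-after-≡ : (i j : Fin n) (i<j : i F.< j) → toℕ j ≡ suc (toℕ i) → hi (gen-after i j i<j) ≡ j
gen-after-≡ i j i<j e = FP.toℕ-injective (trans (toℕ-hi (gen-after i j i<j)) (sym e))

gen-after-< : (i j : Fin n) (i<j : i F.< j) → toℕ j ≢ suc (toℕ i) → hi (gen-after i j i<j) F.< j
gen-after-< i j i<j ≢ = subst (ℕ._< toℕ j) (sym (toℕ-hi (gen-after i j i<j))) (ℕP.≤∧≢⇒< i<j (≢ ∘ sym))

gen-before : (i j : Fin n) → i F.< j → toℕ j ≢ suc (toℕ i) →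
  Σ[ g ∈ Gen n ] hi g ≡ j × i F.< lo g × toℕ j ≡ suc (toℕ (lo g))
gen-before i j i<j ≢ with ≤⇒≡suc i<j
... | m , j≡m+1 with gen-ending-at j j≡m+1
...   | g , hg≡j , toℕ-lo = g , hg≡j , i<lo , trans j≡m+1 (cong suc (sym toℕ-lo))
  where
    i<lo : i F.< lo g
    i<lo = subst (toℕ i ℕ.<_) (sym toℕ-lo)
      (ℕP.≤∧≢⇒< (ℕP.≤-pred (subst (suc (toℕ i) ℕ.≤_) j≡m+1 i<j)) (λ e → ≢ (trans j≡m+1 (cong suc (sym e)))))

module _ (x : S n) (ascents : ∀ g → Ascentʳ g x) where

  private
    ≤-values : ∀ m (i : Fin n) → toℕ i ≡ m → toℕ i ℕ.≤ toℕ (x ⟨$⟩ʳ i)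
    ≤-values zero    i e = subst (ℕ._≤ toℕ (x ⟨$⟩ʳ i)) (sym e) z≤n
    ≤-values (suc m) i e with gen-ending-at i e
    ... | g , refl , toℕ-lo = subst (ℕ._≤ toℕ (x ⟨$⟩ʳ hi g)) (sym e)
      (ℕP.≤-<-trans (subst (ℕ._≤ toℕ (x ⟨$⟩ʳ lo g)) toℕ-lo (≤-values m (lo g) toℕ-lo)) (ascents g))

    ≥-values : ∀ d (i : Fin n) → suc (toℕ i + d) ≡ n → toℕ (x ⟨$⟩ʳ i) ℕ.≤ toℕ i
    ≥-values zero     i e =
      ℕP.≤-pred (subst (toℕ (x ⟨$⟩ʳ i) ℕ.<_) (trans (sym e) (cong suc (ℕP.+-identityʳ _))) (FP.toℕ<n _))
    ≥-values (suc d) i e = ℕP.≤-pred (ℕP.<-≤-trans (ascents g) (subst (toℕ (x ⟨$⟩ʳ hi g) ℕ.≤_) (toℕ-hi g) IH))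
      where
        p : suc (toℕ i) ℕ.< n
        p = subst (suc (suc (toℕ i)) ℕ.≤_) e (s≤s (subst (suc (toℕ i) ℕ.≤_) (sym (ℕP.+-suc _ d)) (ℕP.m≤m+n _ _)))
        g : Gen n
        g = i , p
        IH : toℕ (x ⟨$⟩ʳ hi g) ℕ.≤ toℕ (hi g)
        IH = ≥-values d (hi g) (trans (cong (λ t → suc (t + d)) (toℕ-hi g)) (trans (cong suc (sym (ℕP.+-suc _ d))) e))

  ascents⇒≃id : x ≃ P.id
  ascents⇒≃id = mk≃ λ i → FP.toℕ-injective (ℕP.≤-antisym
    (≥-values (n ℕ.∸ suc (toℕ i)) i (ℕP.m+[n∸m]≡n (FP.toℕ<n i)))
    (≤-values (toℕ i) i refl))

descent? : (x : S n) → Dec (Σ[ g ∈ Gen n ] ¬ Ascentʳ g x)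
descent? {n} x with FP.any? (λ i → gen? i)
  where
    gen? : (i : Fin n) → Dec (Σ[ p ∈ suc (toℕ i) ℕ.< n ] ¬ Ascentʳ (i , p) x)
    gen? i with suc (toℕ i) ℕP.<? n
    ... | no ¬p = no λ (p , _) → ¬p p
    ... | yes p with ascentʳ? (i , p) x
    ...   | yes asc = no λ (p′ , ¬asc) → ¬asc (subst (λ q → Ascentʳ (i , q) x) (ℕP.<-irrelevant p p′) asc)
    ...   | no ¬asc = yes (p , ¬asc)
... | yes (i , p , ¬asc) = yes ((i , p) , ¬asc)
... | no none            = no λ ((i , p) , ¬asc) → none (i , p , ¬asc)

IsAtom-id : IsAtom (P.id {n}) P.id
IsAtom-id {n} = record
  { square  = [] , ((λ _ → refl) , sym (trans (ℓ-⁻¹ (P.id {n})) (ℓ-id {n}))) , nil (λ _ → refl)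
  ; doubleℓ = trans (cong₂ _+_ (ℓ-id {n}) (ℓ-id {n})) (sym (twiceInvLength-id {n})) }

-- Opaque because unfolding it during conversion checking is prohibitively slow.
opaque
  descent-induction : (P : S n → Set) →
    (∀ {x} → Invol x → (∀ g → ¬ Ascentʳ g x → P (g ⋉ x)) → P x) → ∀ {x} → Invol x → P x
  descent-induction {n} P step {x} inv = go (suc (twiceInvLength x)) inv (ℕP.n<1+n _)
    where
      go : ∀ k {x : S n} → Invol x → twiceInvLength x ℕ.< k → P x
      go (suc k) {x} inv ψ<k = step inv λ g ¬asc → go k (Invol-⋉ g inv)
        (ℕP.<-trans (ℕP.n<1+n _) (subst (ℕ._≤ k) (twiceInvLength-descent g inv ¬asc) (ℕP.≤-pred ψ<k)))

atom-exists : (x : S n) → Invol x → Σ[ v ∈ S n ] IsAtom x v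
atom-exists {n} x = descent-induction (λ (x : S n) → Σ[ v ∈ S n ] IsAtom x v) step {x}
  where
    step : ∀ {x : S n} → Invol x → (∀ g → ¬ Ascentʳ g x → Σ[ u ∈ S n ] IsAtom (g ⋉ x) u) →
      Σ[ v ∈ S n ] IsAtom x v
    step {x} inv IH with descent? x
    ... | yes (g , ¬asc) = let (u , atᵘ) = IH g ¬asc in u · s g , IsAtom-extend g inv ¬asc atᵘ
    ... | no none = P.id , IsAtom-cong (≃-sym x≃id) IsAtom-id
      where
        x≃id : x ≃ P.id
        x≃id = ascents⇒≃id x λ g → decidable-stable (ascentʳ? g x) λ ¬asc → none (g , ¬asc)

m+m≤n+n⇒m≤n : {m k : ℕ} → m + m ℕ.≤ k + k → m ℕ.≤ k
m+m≤n+n⇒m≤n {m} {k} h with m ℕP.≤? k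
... | yes m≤k = m≤k
... | no m≰k  = ⊥-elim (ℕP.<-irrefl refl (ℕP.<-≤-trans (ℕP.+-mono-< (ℕP.≰⇒> m≰k) (ℕP.≰⇒> m≰k)) h))

IsAtom⇒𝒜 : {x v : S n} → IsAtom x v → 𝒜 x v
IsAtom⇒𝒜 at = square at , λ v′ sq′ →
  m+m≤n+n⇒m≤n (subst (ℕ._≤ ℓ v′ + ℓ v′) (sym (doubleℓ at)) (proj₂ (DemazureSquare-bound sq′)))

𝒜⇒IsAtom : {x v : S n} → Invol x → 𝒜 x v → IsAtom x v
𝒜⇒IsAtom {x = x} {v} inv (sq , minimal) = record { square = sq ; doubleℓ = ℕP.≤-antisym upper lower }
  where
    u,atᵘ = atom-exists x inv
    atᵘ = proj₂ u,atᵘ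
    ℓv≤ℓu = minimal (proj₁ u,atᵘ) (square atᵘ)
    upper : ℓ v + ℓ v ℕ.≤ twiceInvLength x
    upper = subst (ℓ v + ℓ v ℕ.≤_) (doubleℓ atᵘ) (ℕP.+-mono-≤ ℓv≤ℓu ℓv≤ℓu)
    lower : twiceInvLength x ℕ.≤ ℓ v + ℓ v
    lower = proj₂ (DemazureSquare-bound sq)

record Peel (x v : S n) : Set where
  field
    gen     : Gen n
    descent : ¬ Ascentʳ gen x
    atom    : IsAtom (gen ⋉ x) (v · s gen)

IsAtom-peel : {x v : S n} → IsAtom x v → (v ≃ P.id × x ≃ P.id) ⊎ Peel x v
IsAtom-peel {x = x} {v} at with square at
... | [] , (prod≈ , _) , dw = inj₁ (v≃id , ≃-trans (DemWord⇒≃ dw) v≃id)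
  where
    v≃id : v ≃ P.id
    v≃id = ⁻¹≃id (≃-sym (mk≃ prod≈))
... | a ∷ as , red , dw = inj₂ record { gen = a ; descent = ¬ascˣ ; atom = IsAtom-cong y≃ atʸ }
  where
    open ReducedCons (reducedCons a as v red)
    y = as ⊳* (v · s a)
    x≃ : x ≃ a ⊳ y ⊲ a
    x≃ = ≃-trans (DemWord⇒≃ dw) fold
    bound = reducedWord-bound as (v · s a) y reduced ≃-refl
    invʸ = proj₁ bound
    ψx≡ : twiceInvLength x ≡ 2 + (ℓ (v · s a) + ℓ (v · s a))
    ψx≡ = trans (sym (doubleℓ at)) (trans (cong₂ _+_ ℓ-suc ℓ-suc) (cong suc (ℕP.+-suc _ _)))
    ascʸ : Ascentʳ a y
    ascʸ = decidable-stable (ascentʳ? a y) λ ¬asc → ℕP.<-irrefl refl (begin-strict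
      twiceInvLength x                       ≡⟨ twiceInvLength-cong (≃-trans x≃ (⊳⊲-descent a invʸ ¬asc)) ⟩
      twiceInvLength y                       ≤⟨ proj₂ bound ⟩
      ℓ (v · s a) + ℓ (v · s a)              <⟨ ℕP.n<1+n _ ⟩
      suc (ℓ (v · s a) + ℓ (v · s a))        <⟨ ℕP.n<1+n _ ⟩
      2 + (ℓ (v · s a) + ℓ (v · s a))        ≡⟨ ψx≡ ⟨
      twiceInvLength x                       ∎)
      where open ℕP.≤-Reasoning
    x≃⋉ : x ≃ a ⋉ y
    x≃⋉ = ≃-trans x≃ (⊳⊲-ascent a invʸ ascʸ)
    ¬ascˣ : ¬ Ascentʳ a x
    ¬ascˣ = ⋉-descent a y ascʸ ∘ Ascentʳ-cong a x≃⋉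
    y≃ : y ≃ a ⋉ x
    y≃ = ≃-trans (≃-sym (⋉-involutive a y)) (⋉-cong a (≃-sym x≃⋉))
    atʸ : IsAtom y (v · s a)
    atʸ = record
      { square  = as , reduced , ≃⇒DemWord as ≃-refl
      ; doubleℓ = ℕP.suc-injective (ℕP.suc-injective (trans (sym ψx≡)
                    (trans (twiceInvLength-cong x≃⋉) (twiceInvLength-⋉ a invʸ ascʸ)))) }

Contains321 : S n → Set
Contains321 {n} w = Σ (Fin n) λ i → Σ (Fin n) λ j → Σ (Fin n) λ k →
  (i F.< j) × (j F.< k) × (w ⟨$⟩ʳ j F.< w ⟨$⟩ʳ i) × (w ⟨$⟩ʳ k F.< w ⟨$⟩ʳ j)

Contains321-cong : {u v : S n} → u ≃ v → Contains321 u → Contains321 v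
Contains321-cong (mk≃ e) (i , j , k , i<j , j<k , c , d) =
  i , j , k , i<j , j<k , subst₂ F._<_ (e j) (e i) c , subst₂ F._<_ (e k) (e j) d

Contains321-·s : (g : Gen n) (w : S n) → Ascentʳ g w → Contains321 w → Contains321 (w · s g)
Contains321-·s g w asc (i , j , k , i<j , j<k , c , d) =
  σ g i , σ g j , σ g k ,
  σ-mono g i<j (λ (e₁ , e₂) → ℕP.<-asym asc (subst₂ (λ a b → w ⟨$⟩ʳ b F.< w ⟨$⟩ʳ a) e₁ e₂ c)) ,
  σ-mono g j<k (λ (e₁ , e₂) → ℕP.<-asym asc (subst₂ (λ a b → w ⟨$⟩ʳ b F.< w ⟨$⟩ʳ a) e₁ e₂ d)) ,
  subst₂ F._<_ (cong (w ⟨$⟩ʳ_) (sym (σ-involutive g j))) (cong (w ⟨$⟩ʳ_) (sym (σ-involutive g i))) c ,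
  subst₂ F._<_ (cong (w ⟨$⟩ʳ_) (sym (σ-involutive g k))) (cong (w ⟨$⟩ʳ_) (sym (σ-involutive g j))) d

Contains321-s· : (g : Gen n) (w : S n) → Ascentˡ g w → Contains321 w → Contains321 (s g · w)
Contains321-s· g w asc (i , j , k , i<j , j<k , c , d) =
  i , j , k , i<j , j<k ,
  σ-mono g c (λ (e₁ , e₂) → ℕP.<-asym i<j (subst₂ F._<_ (⟨$⟩ʳ⇒⟨$⟩ˡ w e₁) (⟨$⟩ʳ⇒⟨$⟩ˡ w e₂) asc)) ,
  σ-mono g d (λ (e₁ , e₂) → ℕP.<-asym j<k (subst₂ F._<_ (⟨$⟩ʳ⇒⟨$⟩ˡ w e₁) (⟨$⟩ʳ⇒⟨$⟩ˡ w e₂) asc))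

Contains321-⊲ : (g : Gen n) (w : S n) → Contains321 w → Contains321 (w ⊲ g)
Contains321-⊲ g w c with ascentʳ? g w
... | yes asc = Contains321-cong (≃-sym (⊲-ascent g w asc)) (Contains321-·s g w asc c)
... | no ¬asc = Contains321-cong (≃-sym (⊲-descent g w ¬asc)) c

Contains321-⊳ : (g : Gen n) (w : S n) → Contains321 w → Contains321 (g ⊳ w)
Contains321-⊳ g w c with ascentˡ? g w
... | yes asc = Contains321-cong (≃-sym (⊳-ascent g w asc)) (Contains321-s· g w asc c)
... | no ¬asc = Contains321-cong (≃-sym (⊳-descent g w ¬asc)) c

Avoids321-⋉ : (g : Gen n) {x : S n} → Invol x → ¬ Ascentʳ g x → Avoids321 x → Avoids321 (g ⋉ x)
Avoids321-⋉ g {x} inv ¬asc avoids c =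
  avoids (Contains321-cong {u = g ⊳ (g ⋉ x) ⊲ g} {x} (⊳⊲-⋉ g inv ¬asc)
    (Contains321-⊳ g ((g ⋉ x) ⊲ g) (Contains321-⊲ g (g ⋉ x) c)))

adjacent-descents⇒321 : (a b : Gen n) (x : S n) → hi a ≡ lo b → ¬ Ascentʳ a x → ¬ Ascentʳ b x → Contains321 x
adjacent-descents⇒321 a b x e ¬ascᵃ ¬ascᵇ =
  lo a , lo b , hi b , subst (lo a F.<_) e (lo<hi a) , lo<hi b ,
  subst (λ k → x ⟨$⟩ʳ k F.< x ⟨$⟩ʳ lo a) e (¬ascent⇒descent a x ¬ascᵃ) , ¬ascent⇒descent b x ¬ascᵇ

Far : Gen n → Gen n → Set
Far a b = hi a F.< lo b ⊎ hi b F.< lo a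

Far-sym : {a b : Gen n} → Far a b → Far b a
Far-sym = [ inj₂ , inj₁ ]

data Relative (a b : Gen n) : Set where
  same      : a ≡ b → Relative a b
  adjacent  : hi a ≡ lo b → Relative a b
  adjacent′ : hi b ≡ lo a → Relative a b
  distant   : Far a b → Relative a b

Gen-≡ : {a b : Gen n} → lo a ≡ lo b → a ≡ b
Gen-≡ {a = i , p} {.i , q} refl = cong (i ,_) (ℕP.<-irrelevant p q)

relative : (a b : Gen n) → Relative a b
relative a b with ℕP.<-cmp (toℕ (lo a)) (toℕ (lo b))
... | tri≈ _ e _ = same (Gen-≡ (FP.toℕ-injective e))
... | tri< lo<lo _ _ with hi a FP.≟ lo b
...   | yes e  = adjacent e
...   | no ¬e  = distant (inj₁ (lo<⇒hi< a (¬e ∘ sym) lo<lo))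
relative a b | tri> _ _ lo>lo with hi b FP.≟ lo a
...   | yes e  = adjacent′ e
...   | no ¬e  = distant (inj₂ (lo<⇒hi< b (¬e ∘ sym) lo>lo))

σ-far-lo : (a b : Gen n) → Far a b → σ a (lo b) ≡ lo b
σ-far-lo a b (inj₁ hiᵃ<loᵇ) = σ-above a hiᵃ<loᵇ
σ-far-lo a b (inj₂ hiᵇ<loᵃ) = σ-below a (ℕP.<-trans (lo<hi b) hiᵇ<loᵃ)

σ-far-hi : (a b : Gen n) → Far a b → σ a (hi b) ≡ hi b
σ-far-hi a b (inj₁ hiᵃ<loᵇ) = σ-above a (ℕP.<-trans hiᵃ<loᵇ (lo<hi b))
σ-far-hi a b (inj₂ hiᵇ<loᵃ) = σ-below a hiᵇ<loᵃ

σ-injective : (g : Gen n) {i j : Fin n} → σ g i ≡ σ g j → i ≡ j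
σ-injective g {i} {j} e = trans (sym (σ-involutive g i)) (trans (cong (σ g) e) (σ-involutive g j))

σ-comm : (a b : Gen n) → Far a b → ∀ k → σ a (σ b k) ≡ σ b (σ a k)
σ-comm a b far k with position b k
... | at-lo refl = trans (cong (σ a) (σ-lo b)) (trans (σ-far-hi a b far) (sym (trans (cong (σ b) (σ-far-lo a b far)) (σ-lo b))))
... | at-hi refl = trans (cong (σ a) (σ-hi b)) (trans (σ-far-lo a b far) (sym (trans (cong (σ b) (σ-far-hi a b far)) (σ-hi b))))
... | elsewhere k≢lo k≢hi = trans (cong (σ a) (σ-elsewhere b k≢lo k≢hi)) (sym (σ-elsewhere b
        (λ e → k≢lo (σ-injective a (trans e (sym (σ-far-lo a b far)))))
        (λ e → k≢hi (σ-injective a (trans e (sym (σ-far-hi a b far)))))))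

Ends-σ-far : (a b : Gen n) → Far a b → {i j : Fin n} → Ends b i j → Ends b (σ a i) (σ a j)
Ends-σ-far a b far (inj₁ (refl , refl)) = inj₁ (σ-far-lo a b far , σ-far-hi a b far)
Ends-σ-far a b far (inj₂ (refl , refl)) = inj₂ (σ-far-hi a b far , σ-far-lo a b far)

Ends-σ-far⁻ : (a b : Gen n) → Far a b → {i j : Fin n} → Ends b (σ a i) (σ a j) → Ends b i j
Ends-σ-far⁻ a b far {i} {j} ends =
  subst₂ (Ends b) (σ-involutive a i) (σ-involutive a j) (Ends-σ-far a b far ends)

Stable-twistᵇ-far : (p : Bool) (a b : Gen n) (x : S n) → Far a b → Stable b (twistᵇ p a x) → Stable b x
Stable-twistᵇ-far true  a b x far st =
  subst₂ (λ i j → Ends b (x ⟨$⟩ʳ i) (x ⟨$⟩ʳ j)) (σ-far-lo a b far) (σ-far-hi a b far) st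
Stable-twistᵇ-far false a b x far st = Ends-σ-far⁻ a b far
  (subst₂ (λ i j → Ends b (σ a (x ⟨$⟩ʳ i)) (σ a (x ⟨$⟩ʳ j))) (σ-far-lo a b far) (σ-far-hi a b far) st)

Stable-twistᵇ-far⁻ : (p : Bool) (a b : Gen n) (x : S n) → Far a b → Stable b x → Stable b (twistᵇ p a x)
Stable-twistᵇ-far⁻ true  a b x far st =
  subst₂ (λ i j → Ends b (x ⟨$⟩ʳ i) (x ⟨$⟩ʳ j)) (sym (σ-far-lo a b far)) (sym (σ-far-hi a b far)) st
Stable-twistᵇ-far⁻ false a b x far st =
  subst₂ (λ i j → Ends b (σ a (x ⟨$⟩ʳ i)) (σ a (x ⟨$⟩ʳ j))) (sym (σ-far-lo a b far)) (sym (σ-far-hi a b far))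
    (Ends-σ-far a b far st)

stable-⋉-far : (a b : Gen n) (x : S n) → Far a b → does (stable? b (a ⋉ x)) ≡ does (stable? b x)
stable-⋉-far a b x far = does-cong (stable? b (a ⋉ x)) (stable? b x)
  (Stable-twistᵇ-far p a b x far) (Stable-twistᵇ-far⁻ p a b x far)
  where p = does (stable? a x)

twistᵇ-comm : (p q : Bool) (a b : Gen n) (x : S n) → Far a b → twistᵇ q b (twistᵇ p a x) ≃ twistᵇ p a (twistᵇ q b x)
twistᵇ-comm true  true  a b x far = mk≃ λ k → cong (x ⟨$⟩ʳ_) (σ-comm a b far k)
twistᵇ-comm true  false a b x far = mk≃ λ k → cong (σ b ∘ (x ⟨$⟩ʳ_)) (σ-comm a b far k)
twistᵇ-comm false true  a b x far = mk≃ λ k → cong (σ a ∘ (x ⟨$⟩ʳ_)) (σ-comm a b far k)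
twistᵇ-comm false false a b x far = mk≃ λ k →
  trans (sym (σ-comm a b far (x ⟨$⟩ʳ σ a (σ b k)))) (cong (σ a ∘ σ b ∘ (x ⟨$⟩ʳ_)) (σ-comm a b far k))

⋉-comm : (a b : Gen n) (x : S n) → Far a b → b ⋉ a ⋉ x ≃ a ⋉ b ⋉ x
⋉-comm a b x far = begin
  b ⋉ a ⋉ x                ≡⟨ cong (λ q → twistᵇ q b (a ⋉ x)) (stable-⋉-far a b x far) ⟩
  twistᵇ q b (twistᵇ p a x) ≈⟨ twistᵇ-comm p q a b x far ⟩
  twistᵇ p a (twistᵇ q b x) ≡⟨ cong (λ p → twistᵇ p a (b ⋉ x)) (stable-⋉-far b a x (Far-sym {a = a} {b} far)) ⟨
  a ⋉ b ⋉ x                ∎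
  where
    open ≃-Reasoning
    p = does (stable? a x)
    q = does (stable? b x)

-- If x exchanged the ends of the far generators a and b, then these four points would carry a 321.
far-descent : (a b : Gen n) {x : S n} → Invol x → Avoids321 x → Far a b → ¬ Ascentʳ b x → ¬ Ascentʳ b (a ⋉ x)
far-descent a b {x} inv avoids far ¬asc with stable? a x | ¬ascent⇒descent b x ¬asc
... | yes st | desc = λ asc → ℕP.<-asym desc (subst₂ F._<_
      (trans (app (⋉-stable a x st) (lo b)) (cong (x ⟨$⟩ʳ_) (σ-far-lo a b far)))
      (trans (app (⋉-stable a x st) (hi b)) (cong (x ⟨$⟩ʳ_) (σ-far-hi a b far))) asc)
... | no ¬st | desc = λ asc → ℕP.<-asym (σ-mono a desc exchanged) (subst₂ F._<_
      (trans (app (⋉-unstable a x ¬st) (lo b)) (cong (σ a ∘ (x ⟨$⟩ʳ_)) (σ-far-lo a b far)))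
      (trans (app (⋉-unstable a x ¬st) (hi b)) (cong (σ a ∘ (x ⟨$⟩ʳ_)) (σ-far-hi a b far))) asc)
  where
    exchanged : ¬ (x ⟨$⟩ʳ hi b ≡ lo a × x ⟨$⟩ʳ lo b ≡ hi a)
    exchanged (e₁ , e₂) = avoids ([ left , right ] far)
      where
        xloᵃ = Invol-swap inv e₁
        xhiᵃ = Invol-swap inv e₂
        left : hi a F.< lo b → Contains321 x
        left hiᵃ<loᵇ = lo a , hi a , lo b , lo<hi a , hiᵃ<loᵇ ,
          subst₂ F._<_ (sym xhiᵃ) (sym xloᵃ) (lo<hi b) , subst₂ F._<_ (sym e₂) (sym xhiᵃ) hiᵃ<loᵇ
        right : hi b F.< lo a → Contains321 x
        right hiᵇ<loᵃ = lo b , hi b , lo a , lo<hi b , hiᵇ<loᵃ ,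
          subst₂ F._<_ (sym e₁) (sym e₂) (lo<hi a) , subst₂ F._<_ (sym xloᵃ) (sym e₁) hiᵇ<loᵃ

≃id⇒ascent : (g : Gen n) {x : S n} → x ≃ P.id → Ascentʳ g x
≃id⇒ascent g x≃id = Ascentʳ-cong g (≃-sym x≃id) (lo<hi g)

UniqueAtoms : S n → Set
UniqueAtoms x = ∀ {v₁ v₂} → IsAtom x v₁ → IsAtom x v₂ → v₁ ≃ v₂

·s-cancel : (g : Gen n) {u v : S n} → u · s g ≃ v · s g → u ≃ v
·s-cancel g {u} {v} e = ≃-trans (≃-sym (·s·s g u)) (≃-trans (·-congʳ (s g) e) (·s·s g v))

·s·s-comm : (a b : Gen n) (u : S n) → Far a b → u · s a · s b ≃ u · s b · s a
·s·s-comm a b u far = mk≃ λ k → cong (u ⟨$⟩ʳ_) (σ-comm a b far k)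

-- By uniqueness v₁ ≃ u s_b and v₂ ≃ u s_a for an atom u of b ⋉ a ⋉ x ≃ a ⋉ b ⋉ x; and s_a s_b = s_b s_a.
far-atoms : (a b : Gen n) {x v₁ v₂ : S n} → Invol x → Avoids321 x → Far a b → ¬ Ascentʳ a x → ¬ Ascentʳ b x →
  UniqueAtoms (a ⋉ x) → UniqueAtoms (b ⋉ x) → IsAtom (a ⋉ x) v₁ → IsAtom (b ⋉ x) v₂ → v₁ · s a ≃ v₂ · s b
far-atoms {n} a b {x} {v₁} {v₂} inv avoids far ¬ascᵃ ¬ascᵇ unique₁ unique₂ at₁ at₂ = begin
  v₁ · s a          ≈⟨ ·-congʳ (s a) (unique₁ at₁ atᵘᵇ) ⟩
  u · s b · s a     ≈⟨ ·s·s-comm a b u far ⟨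
  u · s a · s b     ≈⟨ ·-congʳ (s b) (unique₂ atᵘᵃ at₂) ⟩
  v₂ · s b          ∎
  where
    open ≃-Reasoning
    u,at : Σ[ u ∈ S n ] IsAtom (b ⋉ a ⋉ x) u
    u,at = atom-exists (b ⋉ a ⋉ x) (Invol-⋉ b (Invol-⋉ a inv))
    u = proj₁ u,at
    atᵘᵇ : IsAtom (a ⋉ x) (u · s b)
    atᵘᵇ = IsAtom-extend b (Invol-⋉ a inv) (far-descent a b inv avoids far ¬ascᵇ) (proj₂ u,at)
    atᵘᵃ : IsAtom (b ⋉ x) (u · s a)
    atᵘᵃ = IsAtom-extend a (Invol-⋉ b inv) (far-descent b a inv avoids (Far-sym {a = a} {b} far) ¬ascᵃ)
             (IsAtom-cong (⋉-comm a b x far) (proj₂ u,at))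

avoids321⇒UniqueAtoms : (x : S n) → Invol x → Avoids321 x → UniqueAtoms x
avoids321⇒UniqueAtoms {n} x = descent-induction (λ (x : S n) → Avoids321 x → UniqueAtoms x) step {x}
  where
    step : ∀ {x : S n} → Invol x → (∀ g → ¬ Ascentʳ g x → Avoids321 (g ⋉ x) → UniqueAtoms (g ⋉ x)) →
      Avoids321 x → UniqueAtoms x
    step {x} inv IH′ avoids {v₁} {v₂} at₁ at₂ = peeled (IsAtom-peel at₁) (IsAtom-peel at₂)
      where
        IH : (g : Gen n) → ¬ Ascentʳ g x → UniqueAtoms (g ⋉ x)
        IH g ¬asc = IH′ g ¬asc (Avoids321-⋉ g inv ¬asc avoids)
        peeled : (v₁ ≃ P.id × x ≃ P.id) ⊎ Peel x v₁ → (v₂ ≃ P.id × x ≃ P.id) ⊎ Peel x v₂ → v₁ ≃ v₂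
        peeled (inj₁ (v₁≃id , _)) (inj₁ (v₂≃id , _)) = ≃-trans v₁≃id (≃-sym v₂≃id)
        peeled (inj₁ (_ , x≃id))  (inj₂ p₂)          = ⊥-elim (Peel.descent p₂ (≃id⇒ascent (Peel.gen p₂) x≃id))
        peeled (inj₂ p₁)          (inj₁ (_ , x≃id))  = ⊥-elim (Peel.descent p₁ (≃id⇒ascent (Peel.gen p₁) x≃id))
        peeled (inj₂ p₁)          (inj₂ p₂)          = two-descents (relative a b)
          where
            open Peel p₁ renaming (gen to a; descent to ¬ascᵃ; atom to at₁′)
            open Peel p₂ renaming (gen to b; descent to ¬ascᵇ; atom to at₂′)
            two-descents : Relative a b → v₁ ≃ v₂
            two-descents (same refl) = ·s-cancel a (IH a ¬ascᵃ at₁′ at₂′)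
            two-descents (adjacent e)  = ⊥-elim (avoids (adjacent-descents⇒321 a b x e ¬ascᵃ ¬ascᵇ))
            two-descents (adjacent′ e) = ⊥-elim (avoids (adjacent-descents⇒321 b a x e ¬ascᵇ ¬ascᵃ))
            two-descents (distant far) = begin
              v₁               ≈⟨ ·s·s a v₁ ⟨
              v₁ · s a · s a   ≈⟨ far-atoms a b inv avoids far ¬ascᵃ ¬ascᵇ (IH a ¬ascᵃ) (IH b ¬ascᵇ) at₁′ at₂′ ⟩
              v₂ · s b · s b   ≈⟨ ·s·s b v₂ ⟩
              v₂               ∎
              where open ≃-Reasoning

UniqueAtoms-⋉ : (g : Gen n) {x : S n} → Invol x → ¬ Ascentʳ g x → UniqueAtoms x → UniqueAtoms (g ⋉ x)
UniqueAtoms-⋉ g inv ¬asc unique at₁ at₂ =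
  ·s-cancel g (unique (IsAtom-extend g inv ¬asc at₁) (IsAtom-extend g inv ¬asc at₂))

⋉-exchange-at : (g : Gen n) {x : S n} → Invol x → x ⟨$⟩ʳ lo g ≡ hi g →
  ∀ k → (g ⋉ x) ⟨$⟩ʳ k ≡ x ⟨$⟩ʳ σ g k
⋉-exchange-at g {x} inv e = app (⋉-stable g x (inj₂ (e , Invol-swap inv e)))

⋉-conjugate-at : (g : Gen n) (x : S n) → ¬ Ascentʳ g x → x ⟨$⟩ʳ lo g ≢ hi g →
  ∀ k → (g ⋉ x) ⟨$⟩ʳ k ≡ σ g (x ⟨$⟩ʳ σ g k)
⋉-conjugate-at g x ¬asc ≢hi = app (⋉-unstable g x λ
  { (inj₁ (e₁ , e₂)) → ¬asc (subst₂ F._<_ (sym e₁) (sym e₂) (lo<hi g))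
  ; (inj₂ (e₁ , _))  → ≢hi e₁ })

321-at : (w : S n) (i j k : Fin n) {a b c : Fin n} → i F.< j → j F.< k →
  w ⟨$⟩ʳ i ≡ a → w ⟨$⟩ʳ j ≡ b → w ⟨$⟩ʳ k ≡ c → b F.< a → c F.< b → Contains321 w
321-at w i j k i<j j<k refl refl refl b<a c<b = i , j , k , i<j , j<k , b<a , c<b

-- A 321 at i < j < k moves to σ i < σ j < σ k, unless σ g breaks one of its two inversions.
⋉-321 : (g : Gen n) {x : S n} → Invol x → ¬ Ascentʳ g x → (i j k : Fin n) →
  i F.< j → j F.< k → x ⟨$⟩ʳ j F.< x ⟨$⟩ʳ i → x ⟨$⟩ʳ k F.< x ⟨$⟩ʳ j →
  ¬ (i ≡ lo g × j ≡ hi g) → ¬ (j ≡ lo g × k ≡ hi g) →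
  ¬ (x ⟨$⟩ʳ j ≡ lo g × x ⟨$⟩ʳ i ≡ hi g) → ¬ (x ⟨$⟩ʳ k ≡ lo g × x ⟨$⟩ʳ j ≡ hi g) →
  Contains321 (g ⋉ x)
⋉-321 g {x} inv ¬asc i j k i<j j<k xj<xi xk<xj ij jk xji xkj = by-cases (x ⟨$⟩ʳ lo g FP.≟ hi g)
  where
    by-cases : Dec (x ⟨$⟩ʳ lo g ≡ hi g) → Contains321 (g ⋉ x)
    by-cases (yes e) = 321-at (g ⋉ x) (σ g i) (σ g j) (σ g k) (σ-mono g i<j ij) (σ-mono g j<k jk)
      (at i) (at j) (at k) xj<xi xk<xj
      where
        at : ∀ t → (g ⋉ x) ⟨$⟩ʳ σ g t ≡ x ⟨$⟩ʳ t
        at t = trans (⋉-exchange-at g inv e (σ g t)) (cong (x ⟨$⟩ʳ_) (σ-involutive g t))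
    by-cases (no ≢hi) = 321-at (g ⋉ x) (σ g i) (σ g j) (σ g k) (σ-mono g i<j ij) (σ-mono g j<k jk)
      (at i) (at j) (at k) (σ-mono g xj<xi xji) (σ-mono g xk<xj xkj)
      where
        at : ∀ t → (g ⋉ x) ⟨$⟩ʳ σ g t ≡ σ g (x ⟨$⟩ʳ t)
        at t = trans (⋉-conjugate-at g x ¬asc ≢hi (σ g t)) (cong (σ g ∘ (x ⟨$⟩ʳ_)) (σ-involutive g t))

DescentTo321 : S n → Set
DescentTo321 {n} x = Σ[ g ∈ Gen n ] ¬ Ascentʳ g x × Contains321 (g ⋉ x)

-- x acts on three consecutive points p < p+1 < p+2 as the transposition (p p+2).
Block321 : S n → Set
Block321 {n} x = Σ[ c ∈ Gen n ] Σ[ d ∈ Gen n ] hi c ≡ lo d × x ⟨$⟩ʳ lo c ≡ hi d × x ⟨$⟩ʳ hi c ≡ hi c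

module _ {x : S n} (inv : Invol x) where

  private
    swap = Invol-swap inv
    xx = involutive inv
    inj = ⟨$⟩ʳ-injective x

  module Consecutive321 (c d : Gen n) (hc≡ld : hi c ≡ lo d)
    (xq<xp : x ⟨$⟩ʳ lo d F.< x ⟨$⟩ʳ lo c) (xr<xq : x ⟨$⟩ʳ hi d F.< x ⟨$⟩ʳ lo d) where

    private
      p = lo c
      q = lo d
      r = hi d
      p<q : p F.< q
      p<q = subst (p F.<_) hc≡ld (lo<hi c)
      q<r : q F.< r
      q<r = lo<hi d
      ¬ascᶜ : ¬ Ascentʳ c x
      ¬ascᶜ asc = ℕP.<-asym xq<xp (subst (λ t → x ⟨$⟩ʳ p F.< x ⟨$⟩ʳ t) hc≡ld asc)
      ¬ascᵈ : ¬ Ascentʳ d x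
      ¬ascᵈ asc = ℕP.<-asym xr<xq asc

    middle-fixed : x ⟨$⟩ʳ q ≡ q → DescentTo321 x ⊎ Block321 x
    middle-fixed fixed with x ⟨$⟩ʳ p FP.≟ r
    ... | yes xp≡r = inj₂ (c , d , hc≡ld , xp≡r , trans (cong (x ⟨$⟩ʳ_) hc≡ld) (trans fixed (sym hc≡ld)))
    ... | no xp≢r = inj₁ (d , ¬ascᵈ , ⋉-321 d inv ¬ascᵈ p q (x ⟨$⟩ʳ p) p<q q<xp
            xq<xp (subst₂ F._<_ (sym (xx p)) (sym fixed) p<q)
            (λ (e , _) → <⇒≢ p<q e) (λ (_ , e) → xp≢r e)
            (λ (_ , e) → xp≢r e) (λ (_ , e) → <⇒≢ q<r (trans (sym fixed) e)))
      where
        q<xp : q F.< x ⟨$⟩ʳ p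
        q<xp = subst (F._< x ⟨$⟩ʳ p) fixed xq<xp

    middle-up : q F.< x ⟨$⟩ʳ q → DescentTo321 x
    middle-up q<xq with x ⟨$⟩ʳ q FP.≟ r
    ... | yes xq≡r = d , ¬ascᵈ , ⋉-321 d inv ¬ascᵈ p r (x ⟨$⟩ʳ p) (ℕP.<-trans p<q q<r) r<xp
            (ℕP.<-trans xr<xq xq<xp) (subst₂ F._<_ (sym (xx p)) (sym (swap xq≡r)) p<q)
            (λ (e , _) → <⇒≢ p<q e) (λ (e , _) → <⇒≢ q<r (sym e))
            (λ (_ , e) → <⇒≢ p<q (inj (trans e (sym xq≡r)))) (λ (_ , e) → <⇒≢ q<r (trans (sym (swap xq≡r)) e))
      where
        r<xp : r F.< x ⟨$⟩ʳ p
        r<xp = subst (F._< x ⟨$⟩ʳ p) xq≡r xq<xp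
    ... | no xq≢r = d , ¬ascᵈ , ⋉-321 d inv ¬ascᵈ p q (x ⟨$⟩ʳ q) p<q q<xq
            xq<xp (subst (F._< x ⟨$⟩ʳ q) (sym (xx q)) q<xq)
            (λ (e , _) → <⇒≢ p<q e) (λ (_ , e) → xq≢r e)
            (λ (e , _) → <⇒≢ q<xq (sym e)) (λ (_ , e) → xq≢r e)

    middle-down : x ⟨$⟩ʳ q F.< q → DescentTo321 x
    middle-down xq<q with x ⟨$⟩ʳ q FP.≟ p
    ... | yes xq≡p = c , ¬ascᶜ , ⋉-321 c inv ¬ascᶜ (x ⟨$⟩ʳ r) q r (ℕP.<-trans xr<xq xq<q) q<r
            (subst₂ F._<_ (sym xq≡p) (sym (xx r)) (ℕP.<-trans p<q q<r)) xr<xq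
            (λ (e , _) → <⇒≢ q<r (inj (trans xq≡p (sym e)))) (λ (e , _) → <⇒≢ p<q (sym e))
            (λ (_ , e) → <⇒≢ q<r (sym (trans (sym (xx r)) (trans e hc≡ld))))
            (λ (_ , e) → <⇒≢ xq<q (trans e hc≡ld))
    ... | no xq≢p = c , ¬ascᶜ , ⋉-321 c inv ¬ascᶜ (x ⟨$⟩ʳ r) (x ⟨$⟩ʳ q) q xr<xq xq<q
            (subst₂ F._<_ (sym (xx q)) (sym (xx r)) q<r) (subst (x ⟨$⟩ʳ q F.<_) (sym (xx q)) xq<q)
            (λ (_ , e) → <⇒≢ xq<q (trans e hc≡ld)) (λ (e , _) → xq≢p e)
            (λ (e , _) → <⇒≢ p<q (sym (trans (sym (xx q)) e))) (λ (e , _) → xq≢p e)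

    descent-or-block : DescentTo321 x ⊎ Block321 x
    descent-or-block with x ⟨$⟩ʳ q FP.≟ q
    ... | yes fixed = middle-fixed fixed
    ... | no moved  = inj₁ ([ middle-down , middle-up ] (≢⇒<⊎> moved))

  left-step : (g : Gen n) (q r : Fin n) → hi g F.< q → q F.< r →
    x ⟨$⟩ʳ q F.< x ⟨$⟩ʳ lo g → x ⟨$⟩ʳ r F.< x ⟨$⟩ʳ q → DescentTo321 x ⊎ x ⟨$⟩ʳ q F.< x ⟨$⟩ʳ hi g
  left-step g q r g<q q<r xq<xp xr<xq with ≢⇒<⊎> (λ e → <⇒≢ g<q (inj e))
  ... | inj₂ xq<xg = inj₂ xq<xg
  ... | inj₁ xg<xq = inj₁ (g , ¬asc , ⋉-321 g inv ¬asc (lo g) q r p<q q<r xq<xp xr<xq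
          (λ (_ , e) → <⇒≢ g<q (sym e)) (λ (e , _) → <⇒≢ p<q (sym e))
          (λ (e₁ , e₂) → <⇒≢ g<q (inj (trans (swap e₂) (sym e₁))))
          (λ (_ , e) → ℕP.<-asym g<q (subst₂ F._<_ (swap e) e xg<xq)))
    where
      p<q : lo g F.< q
      p<q = ℕP.<-trans (lo<hi g) g<q
      ¬asc : ¬ Ascentʳ g x
      ¬asc asc = ℕP.<-asym asc (ℕP.<-trans xg<xq xq<xp)

  right-step : (g : Gen n) (p q : Fin n) → p F.< q → q F.< lo g →
    x ⟨$⟩ʳ q F.< x ⟨$⟩ʳ p → x ⟨$⟩ʳ hi g F.< x ⟨$⟩ʳ q → DescentTo321 x ⊎ x ⟨$⟩ʳ lo g F.< x ⟨$⟩ʳ q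
  right-step g p q p<q q<g xq<xp xr<xq with ≢⇒<⊎> (λ e → <⇒≢ q<g (inj e))
  ... | inj₂ xg<xq = inj₂ xg<xq
  ... | inj₁ xq<xg = inj₁ (g , ¬asc , ⋉-321 g inv ¬asc p q (hi g) p<q q<r xq<xp xr<xq
          (λ (_ , e) → <⇒≢ q<r e) (λ (e , _) → <⇒≢ q<g e)
          (λ (e , _) → ℕP.<-asym q<g (subst₂ F._<_ e (swap e) xq<xg))
          (λ (e₁ , e₂) → <⇒≢ q<g (sym (trans (sym e₁) (swap e₂)))))
    where
      q<r : q F.< hi g
      q<r = ℕP.<-trans q<g (lo<hi g)
      ¬asc : ¬ Ascentʳ g x
      ¬asc asc = ℕP.<-asym asc (ℕP.<-trans xr<xq xq<xg)

  -- Shrink the 321 at p < q < r to three consecutive positions; each step either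
  -- finds a descent that carries a 321 along, or a 321 with a smaller span.
  descent-or-block : Contains321 x → DescentTo321 x ⊎ Block321 x
  descent-or-block (p , q , r , p<q , q<r , xq<xp , xr<xq) =
    search (toℕ r) p q r p<q q<r xq<xp xr<xq (ℕP.m≤n+m (toℕ r) (toℕ p))
    where
      search : ∀ f (p q r : Fin n) → p F.< q → q F.< r → x ⟨$⟩ʳ q F.< x ⟨$⟩ʳ p → x ⟨$⟩ʳ r F.< x ⟨$⟩ʳ q →
        toℕ r ℕ.≤ toℕ p + f → DescentTo321 x ⊎ Block321 x
      search zero p q r p<q q<r _ _ span =
        ⊥-elim (ℕP.<-irrefl refl (ℕP.<-≤-trans (ℕP.<-trans p<q q<r) (subst (toℕ r ℕ.≤_) (ℕP.+-identityʳ _) span)))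
      search (suc f) p q r p<q q<r xq<xp xr<xq span with toℕ q ℕP.≟ suc (toℕ p) | toℕ r ℕP.≟ suc (toℕ q)
      ... | no q≢p+1 | _ = [ inj₁ , (λ xq<xg → search f (hi g) q r g<q q<r xq<xg xr<xq span′) ]
                             (left-step g q r g<q q<r xq<xp xr<xq)
        where
          g = gen-after p q p<q
          g<q = gen-after-< p q p<q q≢p+1
          span′ : toℕ r ℕ.≤ toℕ (hi g) + f
          span′ = subst (toℕ r ℕ.≤_) (trans (ℕP.+-suc (toℕ p) f) (cong (_+ f) (sym (toℕ-hi g)))) span
      ... | yes q≡p+1 | yes r≡q+1 = Consecutive321.descent-or-block c d (gen-after-≡ p q p<q q≡p+1) xq<xp
            (subst (λ t → x ⟨$⟩ʳ t F.< x ⟨$⟩ʳ q) (sym (gen-after-≡ q r q<r r≡q+1)) xr<xq)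
        where
          c = gen-after p q p<q
          d = gen-after q r q<r
      ... | yes _ | no r≢q+1 with gen-before q r q<r r≢q+1
      ...   | g , refl , q<g , toℕ-hi≡ = [ inj₁ , (λ xg<xq → search f p q (lo g) p<q q<g xq<xp xg<xq span′) ]
                                            (right-step g p q p<q q<g xq<xp xr<xq)
        where
          span′ : toℕ (lo g) ℕ.≤ toℕ p + f
          span′ = ℕP.≤-pred (subst₂ ℕ._≤_ toℕ-hi≡ (ℕP.+-suc (toℕ p) f) span)

module Block321 {x : S n} (inv : Invol x) (c d : Gen n) (hc≡ld : hi c ≡ lo d)
                (xp≡r : x ⟨$⟩ʳ lo c ≡ hi d) (xq≡q : x ⟨$⟩ʳ hi c ≡ hi c) where

  private
    p = lo c
    q = hi c
    r = hi d
    inj = ⟨$⟩ʳ-injective x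
    xr≡p : x ⟨$⟩ʳ r ≡ p
    xr≡p = Invol-swap inv xp≡r

  p<q : p F.< q
  p<q = lo<hi c

  q<r : q F.< r
  q<r = subst (F._< r) (sym hc≡ld) (lo<hi d)

  private
    σc-p : σ c p ≡ q
    σc-p = σ-lo c
    σc-q : σ c q ≡ p
    σc-q = σ-hi c
    σc-r : σ c r ≡ r
    σc-r = σ-above c q<r
    σd-p : σ d p ≡ p
    σd-p = σ-below d (subst (p F.<_) hc≡ld p<q)
    σd-q : σ d q ≡ r
    σd-q = trans (cong (σ d) hc≡ld) (σ-lo d)
    σd-r : σ d r ≡ q
    σd-r = trans (σ-hi d) (sym hc≡ld)

  ¬ascᶜ : ¬ Ascentʳ c x
  ¬ascᶜ asc = ℕP.<-asym q<r (subst₂ F._<_ xp≡r xq≡q asc)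

  ¬ascᵈ : ¬ Ascentʳ d x
  ¬ascᵈ asc = ℕP.<-asym p<q (subst₂ F._<_ (trans (cong (x ⟨$⟩ʳ_) (sym hc≡ld)) xq≡q) xr≡p asc)

  c⋉x-at : ∀ k → (c ⋉ x) ⟨$⟩ʳ k ≡ σ c (x ⟨$⟩ʳ σ c k)
  c⋉x-at = ⋉-conjugate-at c x ¬ascᶜ (λ e → <⇒≢ q<r (sym (trans (sym xp≡r) e)))

  d⋉x-at : ∀ k → (d ⋉ x) ⟨$⟩ʳ k ≡ σ d (x ⟨$⟩ʳ σ d k)
  d⋉x-at = ⋉-conjugate-at d x ¬ascᵈ (λ e → <⇒≢ q<r (trans (sym xq≡q) (trans (cong (x ⟨$⟩ʳ_) hc≡ld) e)))

  c⋉x-q : (c ⋉ x) ⟨$⟩ʳ q ≡ r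
  c⋉x-q rewrite c⋉x-at q | σc-q | xp≡r = σc-r

  c⋉x-r : (c ⋉ x) ⟨$⟩ʳ r ≡ q
  c⋉x-r rewrite c⋉x-at r | σc-r | xr≡p = σc-p

  d⋉x-p : (d ⋉ x) ⟨$⟩ʳ p ≡ q
  d⋉x-p rewrite d⋉x-at p | σd-p | xp≡r = σd-r

  d⋉x-q : (d ⋉ x) ⟨$⟩ʳ q ≡ p
  d⋉x-q rewrite d⋉x-at q | σd-q | xr≡p = σd-p

  ¬ascᵈ-c⋉x : ¬ Ascentʳ d (c ⋉ x)
  ¬ascᵈ-c⋉x asc = ℕP.<-asym q<r (subst₂ F._<_ (trans (cong (c ⋉ x ⟨$⟩ʳ_) (sym hc≡ld)) c⋉x-q) c⋉x-r asc)

  ¬ascᶜ-d⋉x : ¬ Ascentʳ c (d ⋉ x)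
  ¬ascᶜ-d⋉x asc = ℕP.<-asym p<q (subst₂ F._<_ d⋉x-p d⋉x-q asc)

  private
    dc-at : ∀ k → (d ⋉ c ⋉ x) ⟨$⟩ʳ k ≡ σ c (x ⟨$⟩ʳ σ c (σ d k))
    dc-at k = trans (⋉-exchange-at d (Invol-⋉ c inv) (trans (cong (c ⋉ x ⟨$⟩ʳ_) (sym hc≡ld)) c⋉x-q) k)
                    (c⋉x-at (σ d k))
    cd-at : ∀ k → (c ⋉ d ⋉ x) ⟨$⟩ʳ k ≡ σ d (x ⟨$⟩ʳ σ d (σ c k))
    cd-at k = trans (⋉-exchange-at c (Invol-⋉ d inv) d⋉x-p k) (d⋉x-at (σ c k))

  -- Both sides fix p, q, r and agree with x elsewhere.
  straighten : d ⋉ c ⋉ x ≃ c ⋉ d ⋉ x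
  straighten = mk≃ λ k → trans (dc-at k) (trans (on k) (sym (cd-at k)))
    where
      on : ∀ k → σ c (x ⟨$⟩ʳ σ c (σ d k)) ≡ σ d (x ⟨$⟩ʳ σ d (σ c k))
      on k with position c k
      ... | at-lo refl rewrite σd-p | σc-p | xq≡q | σc-q | σd-q | xr≡p = sym σd-p
      ... | at-hi refl rewrite σd-q | σc-r | xr≡p | σc-p | σc-q | σd-p | xp≡r = sym σd-r
      ... | elsewhere k≢p k≢q with position d k
      ...   | at-lo k≡lo = ⊥-elim (k≢q (trans k≡lo (sym hc≡ld)))
      ...   | at-hi refl rewrite σc-r | σd-r | σc-q | xq≡q | σd-q | xp≡r | σc-r = refl
      ...   | elsewhere k≢lo k≢r = begin
        σ c (x ⟨$⟩ʳ σ c (σ d k))   ≡⟨ cong (λ t → σ c (x ⟨$⟩ʳ σ c t)) σd-k ⟩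
        σ c (x ⟨$⟩ʳ σ c k)         ≡⟨ cong (λ t → σ c (x ⟨$⟩ʳ t)) σc-k ⟩
        σ c (x ⟨$⟩ʳ k)             ≡⟨ σ-elsewhere c (λ e → k≢r (inj (trans e (sym xr≡p))))
                                                    (λ e → k≢q (inj (trans e (sym xq≡q)))) ⟩
        x ⟨$⟩ʳ k                   ≡⟨ σ-elsewhere d (λ e → k≢q (inj (trans e (trans (sym hc≡ld) (sym xq≡q)))))
                                                    (λ e → k≢p (inj (trans e (sym xp≡r)))) ⟨
        σ d (x ⟨$⟩ʳ k)             ≡⟨ cong (λ t → σ d (x ⟨$⟩ʳ t)) σd-k ⟨
        σ d (x ⟨$⟩ʳ σ d k)         ≡⟨ cong (λ t → σ d (x ⟨$⟩ʳ σ d t)) σc-k ⟨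
        σ d (x ⟨$⟩ʳ σ d (σ c k))   ∎
        where
          open ≡-Reasoning
          σc-k = σ-elsewhere c k≢p k≢q
          σd-k = σ-elsewhere d k≢lo k≢r

-- Both reduced words s_c s_d s_c = s_d s_c s_d of the block transposition (p r) yield an atom:
-- u s_d s_c and u s_c s_d for an atom u of d ⋉ c ⋉ x ≃ c ⋉ d ⋉ x; they differ at p.
block321⇒¬UniqueAtoms : {x : S n} → Invol x → Block321 x → ¬ UniqueAtoms x
block321⇒¬UniqueAtoms {x = x} inv (c , d , hc≡ld , xp≡r , xq≡q) unique = <⇒≢ q<r (sym r≡q)
  where
    open Block321 inv c d hc≡ld xp≡r xq≡q
    u,at = atom-exists (d ⋉ c ⋉ x) (Invol-⋉ d (Invol-⋉ c inv))
    u = proj₁ u,at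
    at₁ : IsAtom x (u · s d · s c)
    at₁ = IsAtom-extend c inv ¬ascᶜ (IsAtom-extend d (Invol-⋉ c inv) ¬ascᵈ-c⋉x (proj₂ u,at))
    at₂ : IsAtom x (u · s c · s d)
    at₂ = IsAtom-extend d inv ¬ascᵈ (IsAtom-extend c (Invol-⋉ d inv) ¬ascᶜ-d⋉x (IsAtom-cong straighten (proj₂ u,at)))
    r≡q : hi d ≡ hi c
    r≡q = begin
      hi d                  ≡⟨ trans (cong (σ d) (σ-lo c)) (trans (cong (σ d) hc≡ld) (σ-lo d)) ⟨
      σ d (σ c (lo c))      ≡⟨ ⟨$⟩ʳ-injective u (app (unique at₁ at₂) (lo c)) ⟩
      σ c (σ d (lo c))      ≡⟨ cong (σ c) (σ-below d (subst (lo c F.<_) hc≡ld p<q)) ⟩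
      σ c (lo c)            ≡⟨ σ-lo c ⟩
      hi c                  ∎
      where open ≡-Reasoning

UniqueAtoms⇒avoids321 : (x : S n) → Invol x → UniqueAtoms x → Avoids321 x
UniqueAtoms⇒avoids321 {n} x = descent-induction (λ (x : S n) → UniqueAtoms x → Avoids321 x) step {x}
  where
    step : ∀ {x : S n} → Invol x → (∀ g → ¬ Ascentʳ g x → UniqueAtoms (g ⋉ x) → Avoids321 (g ⋉ x)) →
      UniqueAtoms x → Avoids321 x
    step inv IH unique c with descent-or-block inv c
    ... | inj₂ block = block321⇒¬UniqueAtoms inv block unique
    ... | inj₁ (g , ¬asc , c′) = IH g ¬asc (UniqueAtoms-⋉ g inv ¬asc unique) c′

exactlyOne𝒜⇔UniqueAtoms : {x : S n} → Invol x → HasExactlyOne (𝒜 x) ⇔ UniqueAtoms x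
exactlyOne𝒜⇔UniqueAtoms {x = x} inv = mk⇔
  (λ (w , _ , only) {v₁} {v₂} at₁ at₂ →
     ≃-trans (mk≃ {u = v₁} {w} (only v₁ (IsAtom⇒𝒜 at₁))) (≃-sym (mk≃ {u = v₂} {w} (only v₂ (IsAtom⇒𝒜 at₂)))))
  (λ unique → let (v , at) = atom-exists x inv in
     v , IsAtom⇒𝒜 at , λ v′ a′ → app (unique (𝒜⇒IsAtom inv a′) at))

corollary6p12 : (n : ℕ) (x : S n) → IsInvolution x →
    HasExactlyOne (𝒜 x) ⇔ Avoids321 x
corollary6p12 n x involution =
  mk⇔ (UniqueAtoms⇒avoids321 x inv) (avoids321⇒UniqueAtoms x inv) ⇔-∘ exactlyOne𝒜⇔UniqueAtoms inv
  where inv = mkInvol involution
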